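{- Let $n\ge 1$ and let $\pi=(a_1,b_1)(a_2,b_2)\cdots(a_k,b_k)\in\mathscr{I}_n$ be an involution written in standard form, with fixed points $c_1<c_2<\dots<c_l$. Then $\mathcal{W}(\pi)$ consists exactly of those permutations $w=[w(1),w(2),\dots,w(n)]\in S_n$ such that all of the following hold: (1) for each $1\le i\le k$, $b_i$ occurs before $a_i$ in $w$, and for any $x$ with $a_i<x<b_i$, $x$ does not occur between $b_i$ and $a_i$ in $w$; (2) if $i<j$ and $b_i<b_j$, then $a_i$ occurs before $b_j$ in $w$; (3) if $i<j$, then $c_i$ occurs before $c_j$ in $w$; (4) if $c_j<a_i$, then $c_j$ occurs before $b_i$ in $w$; (5) if $b_i<c_j$, then $a_i$ occurs before $c_j$ in $w$.
   Context: Permutations are written in one-line notation $w=[w(1),\dots,w(n)]$ and multiplied by composition from right to left; $s_i=(i,i+1)$ is the simple transposition and $\ell(w)$ is the Coxeter length (number of inversions). For $w\in S_n$ and $x,y\in[n]$, "$x$ occurs before $y$ in $w$" means $w^{ -1}(x)<w^{ -1}(y)$; "between" is defined similarly. $\mathscr{I}_n=\{\pi\in S_n:\pi^2=\mathrm{id}\}$. An involution $\pi=(a_1,b_1)\cdots(a_k,b_k)$ (product of disjoint transpositions) is in standard form if $a_i<b_i$ for all $i$ and $a_1<\dots<a_k$. For $\pi\in\mathscr{I}_n$ with $k$ two-cycles, set $L(\pi)=(\ell(\pi)+k)/2$. For $1\le i\le n-1$ and $\pi\in\mathscr{I}_n$ define $m(s_i)\cdot\pi=s_i\pi s_i$ if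 $\ell(s_i\pi s_i)=\ell(\pi)+2$; $m(s_i)\cdot\pi=s_i\pi$ if $\pi(i)=i$ and $\pi(i+1)=i+1$; and $m(s_i)\cdot\pi=\pi$ otherwise. These operators satisfy $m(s_i)^2=m(s_i)$ and the braid relations, so they define an action of the Richardson–Springer monoid; for $w\in S_n$ with any reduced expression $w=s_{i_1}\cdots s_{i_r}$ put $m(w)\cdot\pi=m(s_{i_1})\cdot(m(s_{i_2})\cdot(\cdots m(s_{i_r})\cdot\pi))$, which is independent of the reduced expression. The $\mathcal{W}$-set of $\pi\in\mathscr{I}_n$ is $\mathcal{W}(\pi)=\{w\in S_n: m(w)\cdot\mathrm{id}=\pi\text{ and }\ell(w)=L(\pi)\}$. -}

module Defs where

open import Data.Nat using (ℕ; zero; suc; _+_; _*_)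
open import Data.Fin using (Fin; toℕ; inject₁; _<_; _≟_)
  renaming (suc to fsuc)
open import Data.Fin.Permutation
  using (Permutation′; _⟨$⟩ʳ_; _⟨$⟩ˡ_; _∘ₚ_; transpose; _≈_)
  renaming (id to idₚ)
open import Data.List using (List; []; _∷_; length; filter; allFin; cartesianProduct)
open import Data.Product using (Σ; _×_; _,_; proj₁; proj₂)
open import Relation.Nullary using (¬_; Dec; yes; no)
open import Relation.Binary.PropositionalEquality using (_≡_)
import Data.Nat as ℕ
import Data.Fin as F

-- Permutations of [n] are bijections of Fin n (values 0..n-1 stand for 1..n;
-- only the order on values matters, which is preserved).
-- Composition right to left: (σ · τ)(x) = σ(τ(x)).
_·_ : ∀ {n} → Permutation′ n → Permutation′ n → Permutation′ n
σ · τ = τ ∘ₚ σ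

-- simple transposition s_i = (i, i+1) in S_{m+1}, for i ∈ Fin m (i.e. 1 ≤ i ≤ n-1)
s : ∀ {m} → Fin m → Permutation′ (suc m)
s i = transpose (inject₁ i) (fsuc i)

len : ∀ {n} → Permutation′ n → ℕ
len {n} w = length (filter (λ pq → (w ⟨$⟩ʳ proj₂ pq) F.<? (w ⟨$⟩ʳ proj₁ pq))
                      (filter (λ pq → proj₁ pq F.<? proj₂ pq)
                        (cartesianProduct (allFin n) (allFin n))))

twoCycles : ∀ {n} → Permutation′ n → ℕ
twoCycles {n} π = length (filter (λ a → a F.<? (π ⟨$⟩ʳ a)) (allFin n))

IsInvolution : ∀ {n} → Permutation′ n → Set
IsInvolution π = (π · π) ≈ idₚ

mAct : ∀ {m} → Fin m → Permutation′ (suc m) → Permutation′ (suc m)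
mAct i π with len (s i · (π · s i)) ℕ.≟ (len π + 2)
... | yes _ = s i · (π · s i)
... | no _ with π ⟨$⟩ʳ inject₁ i ≟ inject₁ i | π ⟨$⟩ʳ fsuc i ≟ fsuc i
...   | yes _ | yes _ = s i · π
...   | _     | _     = π

prod : ∀ {m} → List (Fin m) → Permutation′ (suc m)
prod [] = idₚ
prod (i ∷ is) = s i · prod is

mWord : ∀ {m} → List (Fin m) → Permutation′ (suc m) → Permutation′ (suc m)
mWord [] π = π
mWord (i ∷ is) π = mAct i (mWord is π)

-- m(w)·π for w with some reduced expression (independent of the choice)
-- W(π) = { w : m(w)·id = π and ℓ(w) = L(π) }, with L(π) = (ℓ(π)+k)/2
-- written as 2ℓ(w) = ℓ(π) + k.
InW : ∀ {m} → Permutation′ (suc m) → Permutation′ (suc m) → Set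
InW {m} π w =
  Σ (List (Fin m)) λ ws →
    (prod ws ≈ w) × (length ws ≡ len w) × (mWord ws idₚ ≈ π)
  × (2 * len w ≡ len π + twoCycles π)

Before : ∀ {n} → Permutation′ n → Fin n → Fin n → Set
Before w x y = (w ⟨$⟩ˡ x) < (w ⟨$⟩ˡ y)

Between : ∀ {n} → Permutation′ n → Fin n → Fin n → Fin n → Set
Between w x y z = Before w y x × Before w x z

Cycle : ∀ {n} → Permutation′ n → Fin n → Fin n → Set
Cycle π a b = (a < b) × (π ⟨$⟩ʳ a ≡ b)

Fixed : ∀ {n} → Permutation′ n → Fin n → Set
Fixed π c = π ⟨$⟩ʳ c ≡ c

-- Conditions (1)-(5).  Indexing the 2-cycles in standard form means
-- i < j ⇔ a_i < a_j; indexing fixed points increasingly means i < j ⇔ c_i < c_j.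
Conditions : ∀ {n} → Permutation′ n → Permutation′ n → Set
Conditions {n} π w =
    (∀ a b → Cycle π a b →
       Before w b a × (∀ (x : Fin n) → a < x → x < b → ¬ Between w x b a))
  × (∀ a b a′ b′ → Cycle π a b → Cycle π a′ b′ → a < a′ → b < b′ → Before w a b′)
  × (∀ c c′ → Fixed π c → Fixed π c′ → c < c′ → Before w c c′)
  × (∀ a b c → Cycle π a b → Fixed π c → c < a → Before w c b)
  × (∀ a b c → Cycle π a b → Fixed π c → b < c → Before w a c)

-- Write twoL π = ℓ(π) + k(π) = 2 L(π).  Each letter of a word s_{i₁} ⋯ s_{i_r} raises the
-- length of the product by at most one, and each m(s_i) either leaves the involution unchanged or
-- raises twoL by exactly 2.  So w ∈ W(π) exactly when every letter is a left ascent of the product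
-- of the letters to its right and every m(s_i) moves the current involution.
-- Relabelling the values by s_i = (i i+1) preserves their order except on the pair {i , i+1}, so
-- conditions (1)–(5) for (π , w) become the same conditions for (s_i π s_i , s_i w), or for
-- (s_i π , s_i w) when π fixes or swaps i and i+1, up to a case analysis on that one pair.  This
-- carries the conditions along the word.  Conversely, a w satisfying the conditions is either the
-- identity, which forces π = id, or has a left descent s_i, which is peeled off; induct on ℓ(w).

module Submission where

open import Defs
import Data.Nat as ℕ
import Data.Nat.Properties as ℕ
open import Algebra.Properties.CommutativeMonoid.Sum ℕ.+-0-commutativeMonoid
  using (sum; sum-permute; sum-cong-≗; sum-remove; sum-replicate-zero)
open import Data.Bool using (Bool; true; false; _∧_)
open import Data.Empty using (⊥; ⊥-elim)
open import Data.Fin using (Fin; toℕ; inject₁; punchIn; _<_; _≟_; _<?_)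
  renaming (zero to fzero; suc to fsuc)
open import Data.Fin.Properties using (punchInᵢ≢i; <-irrefl; <-asym; <-trans; <-cmp; toℕ-inject₁; toℕ-injective; any?)
open import Data.Fin.Permutation using (Permutation′; _⟨$⟩ʳ_; _⟨$⟩ˡ_; _≈_; inverseˡ; inverseʳ; flip)
  renaming (id to idₚ)
import Data.Fin.Permutation.Components as PC
open import Data.List using (List; []; _∷_; _++_; map; filter; length; allFin; tabulate; cartesianProduct)
open import Data.Nat using (ℕ; zero; suc; _+_; _*_)
open import Data.Nat.ListAction using () renaming (sum to sumᴸ)
open import Data.Nat.ListAction.Properties using (sum-++)
open import Data.Nat.Tactic.RingSolver using (solve-∀)
open import Data.List.Properties using (map-∘; map-cong; map-++)
open import Data.Product using (Σ-syntax; _×_; _,_; proj₁; proj₂)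
open import Data.Sum using (_⊎_; inj₁; inj₂; [_,_]′)
open import Function using (_∘_; _⇔_; mk⇔)
open import Relation.Binary.PropositionalEquality
open import Relation.Binary using (tri<; tri≈; tri>)
open import Relation.Nullary using (¬_; Dec; yes; no; does)
open import Relation.Nullary.Decidable using (dec-true; dec-false; does-⇔)
open import Relation.Unary using (Decidable)

indicator : Bool → ℕ
indicator true = 1
indicator false = 0

module _ {P Q : Set} (P? : Dec P) (Q? : Dec Q) where

  indicator-∧-yes : P → Q → indicator (does P? ∧ does Q?) ≡ 1
  indicator-∧-yes p q rewrite dec-true P? p | dec-true Q? q = refl

  indicator-∧-noˡ : ¬ P → indicator (does P? ∧ does Q?) ≡ 0
  indicator-∧-noˡ ¬p rewrite dec-false P? ¬p = refl

  indicator-∧-noʳ : ¬ Q → indicator (does P? ∧ does Q?) ≡ 0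
  indicator-∧-noʳ ¬q rewrite dec-false Q? ¬q with does P?
  ... | true = refl
  ... | false = refl

module _ {A : Set} where

  sumᴸ-map-++ : (h : A → ℕ) (xs ys : List A) →
                sumᴸ (map h (xs ++ ys)) ≡ sumᴸ (map h xs) + sumᴸ (map h ys)
  sumᴸ-map-++ h xs ys = trans (cong sumᴸ (map-++ h xs ys)) (sum-++ (map h xs) (map h ys))

  length-filter≡sum : {P : A → Set} (P? : Decidable P) (xs : List A) →
                      length (filter P? xs) ≡ sumᴸ (map (indicator ∘ does ∘ P?) xs)
  length-filter≡sum P? [] = refl
  length-filter≡sum P? (x ∷ xs) with does (P? x)
  ... | false = length-filter≡sum P? xs
  ... | true = cong suc (length-filter≡sum P? xs)

  length-filter²≡sum : {P Q : A → Set} (P? : Decidable P) (Q? : Decidable Q) (xs : List A) →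
    length (filter Q? (filter P? xs)) ≡ sumᴸ (map (λ x → indicator (does (P? x) ∧ does (Q? x))) xs)
  length-filter²≡sum P? Q? [] = refl
  length-filter²≡sum P? Q? (x ∷ xs) with does (P? x)
  ... | false = length-filter²≡sum P? Q? xs
  ... | true with does (Q? x)
  ...   | false = length-filter²≡sum P? Q? xs
  ...   | true = cong suc (length-filter²≡sum P? Q? xs)

sumᴸ-map-cartesianProduct : {A B : Set} (h : A × B → ℕ) (xs : List A) (ys : List B) →
  sumᴸ (map h (cartesianProduct xs ys)) ≡ sumᴸ (map (λ x → sumᴸ (map (λ y → h (x , y)) ys)) xs)
sumᴸ-map-cartesianProduct h [] ys = refl
sumᴸ-map-cartesianProduct h (x ∷ xs) ys =
  trans (sumᴸ-map-++ h (map (x ,_) ys) (cartesianProduct xs ys))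
        (cong₂ _+_ (cong sumᴸ (sym (map-∘ ys))) (sumᴸ-map-cartesianProduct h xs ys))

sumᴸ-map-tabulate : ∀ {A : Set} {n} (f : Fin n → A) (g : A → ℕ) → sumᴸ (map g (tabulate f)) ≡ sum (g ∘ f)
sumᴸ-map-tabulate {n = zero} f g = refl
sumᴸ-map-tabulate {n = suc n} f g = cong (g (f fzero) +_) (sumᴸ-map-tabulate (f ∘ fsuc) g)

sumᴸ-map-allFin : ∀ {n} (g : Fin n → ℕ) → sumᴸ (map g (allFin n)) ≡ sum g
sumᴸ-map-allFin g = sumᴸ-map-tabulate (λ x → x) g

inversion : ∀ {n} → (Fin n → Fin n) → Fin n → Fin n → ℕ
inversion w p q = indicator (does (p <? q) ∧ does (w q <? w p))

excedance : ∀ {n} → (Fin n → Fin n) → Fin n → ℕ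
excedance π a = indicator (does (a <? π a))

module _ {n : ℕ} where

  inversion-agree : (w v : Fin n → Fin n) (p q : Fin n) →
    (p < q → does (w q <? w p) ≡ does (v q <? v p)) → inversion w p q ≡ inversion v p q
  inversion-agree w v p q agree with p <? q
  ... | yes p<q rewrite dec-true (p <? q) p<q = cong indicator (agree p<q)
  ... | no p≮q rewrite dec-false (p <? q) p≮q = refl

∑² : ∀ {n} → (Fin n → Fin n → ℕ) → ℕ
∑² F = sum (λ p → sum (F p))

len≡∑²inversion : ∀ {n} (w : Permutation′ n) → len w ≡ ∑² (inversion (w ⟨$⟩ʳ_))
len≡∑²inversion {n} w = begin
    len w
  ≡⟨ length-filter²≡sum (λ (p , q) → p <? q) (λ (p , q) → w ⟨$⟩ʳ q <? w ⟨$⟩ʳ p) pairs ⟩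
    sumᴸ (map (λ (p , q) → inversion (w ⟨$⟩ʳ_) p q) pairs)
  ≡⟨ sumᴸ-map-cartesianProduct _ (allFin n) (allFin n) ⟩
    sumᴸ (map (λ p → sumᴸ (map (inversion (w ⟨$⟩ʳ_) p) (allFin n))) (allFin n))
  ≡⟨ cong sumᴸ (map-cong (λ p → sumᴸ-map-allFin (inversion (w ⟨$⟩ʳ_) p)) (allFin n)) ⟩
    sumᴸ (map (λ p → sum (inversion (w ⟨$⟩ʳ_) p)) (allFin n))
  ≡⟨ sumᴸ-map-allFin (λ p → sum (inversion (w ⟨$⟩ʳ_) p)) ⟩
    ∑² (inversion (w ⟨$⟩ʳ_))
  ∎
  where
  open ≡-Reasoning
  pairs = cartesianProduct (allFin n) (allFin n)

twoCycles≡∑excedance : ∀ {n} (π : Permutation′ n) → twoCycles π ≡ sum (excedance (π ⟨$⟩ʳ_))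
twoCycles≡∑excedance {n} π =
  trans (length-filter≡sum (λ a → a <? (π ⟨$⟩ʳ a)) (allFin n)) (sumᴸ-map-allFin (excedance (π ⟨$⟩ʳ_)))

sum≡0 : ∀ {n} (f : Fin n → ℕ) → (∀ x → f x ≡ 0) → sum f ≡ 0
sum≡0 {n} f f≡0 = trans (sum-cong-≗ f≡0) (sum-replicate-zero n)

sum-≤ : ∀ {n} (f g : Fin n → ℕ) → (∀ x → f x ℕ.≤ g x) → sum f ℕ.≤ sum g
sum-≤ {zero} f g f≤g = ℕ.z≤n
sum-≤ {suc n} f g f≤g = ℕ.+-mono-≤ (f≤g fzero) (sum-≤ (f ∘ fsuc) (g ∘ fsuc) (f≤g ∘ fsuc))

sum-≤-equal : ∀ {n} (f g : Fin n → ℕ) → (∀ x → f x ℕ.≤ g x) → sum f ≡ sum g → ∀ x → f x ≡ g x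
sum-≤-equal {suc n} f g f≤g ∑f≡∑g = pointwise
  where
  rest≤ = sum-≤ (f ∘ fsuc) (g ∘ fsuc) (f≤g ∘ fsuc)
  head≡ : f fzero ≡ g fzero
  head≡ = ℕ.≤-antisym (f≤g fzero)
            (ℕ.≮⇒≥ (λ f₀<g₀ → ℕ.<-irrefl ∑f≡∑g (ℕ.+-mono-<-≤ f₀<g₀ rest≤)))
  rest≡ : sum (f ∘ fsuc) ≡ sum (g ∘ fsuc)
  rest≡ = ℕ.+-cancelˡ-≡ (f fzero) _ _ (trans ∑f≡∑g (cong (_+ sum (g ∘ fsuc)) (sym head≡)))
  pointwise : ∀ x → f x ≡ g x
  pointwise fzero = head≡
  pointwise (fsuc x) = sum-≤-equal (f ∘ fsuc) (g ∘ fsuc) (f≤g ∘ fsuc) rest≡ x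

sum-agree-off : ∀ {n} (f g : Fin n → ℕ) (x₀ : Fin n) →
                (∀ x → x ≢ x₀ → f x ≡ g x) → sum f + g x₀ ≡ sum g + f x₀
sum-agree-off {suc n} f g x₀ agree = begin
    sum f + g x₀                              ≡⟨ cong (_+ g x₀) (sum-remove {i = x₀} f) ⟩
    (f x₀ + sum (f ∘ punchIn x₀)) + g x₀      ≡⟨ cong (λ t → (f x₀ + t) + g x₀) rest ⟩
    (f x₀ + sum (g ∘ punchIn x₀)) + g x₀      ≡⟨ swap (f x₀) (sum (g ∘ punchIn x₀)) (g x₀) ⟩
    (g x₀ + sum (g ∘ punchIn x₀)) + f x₀      ≡⟨ cong (_+ f x₀) (sym (sum-remove {i = x₀} g)) ⟩
    sum g + f x₀                              ∎
  where
  open ≡-Reasoning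
  rest : sum (f ∘ punchIn x₀) ≡ sum (g ∘ punchIn x₀)
  rest = sum-cong-≗ (λ y → agree (punchIn x₀ y) (punchInᵢ≢i x₀ y))
  swap : ∀ a r b → (a + r) + b ≡ (b + r) + a
  swap = solve-∀

∑²-agree-off : ∀ {n} (F G : Fin n → Fin n → ℕ) (p₀ q₀ : Fin n) →
  (∀ p q → ¬ (p ≡ p₀ × q ≡ q₀) → F p q ≡ G p q) → ∑² F + G p₀ q₀ ≡ ∑² G + F p₀ q₀
∑²-agree-off F G p₀ q₀ agree = ℕ.+-cancelʳ-≡ (sum (G p₀) + sum (F p₀)) _ _ (begin
    (∑² F + G p₀ q₀) + (sum (G p₀) + sum (F p₀))   ≡⟨ regroup (∑² F) _ _ _ ⟩
    (∑² F + sum (G p₀)) + (sum (F p₀) + G p₀ q₀)   ≡⟨ cong₂ _+_ rows row₀ ⟩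
    (∑² G + sum (F p₀)) + (sum (G p₀) + F p₀ q₀)   ≡⟨ regroup′ (∑² G) _ _ _ ⟩
    (∑² G + F p₀ q₀) + (sum (G p₀) + sum (F p₀))   ∎)
  where
  open ≡-Reasoning
  rows : ∑² F + sum (G p₀) ≡ ∑² G + sum (F p₀)
  rows = sum-agree-off (λ p → sum (F p)) (λ p → sum (G p)) p₀
           (λ p p≢p₀ → sum-cong-≗ (λ q → agree p q (p≢p₀ ∘ proj₁)))
  row₀ : sum (F p₀) + G p₀ q₀ ≡ sum (G p₀) + F p₀ q₀
  row₀ = sum-agree-off (F p₀) (G p₀) q₀ (λ q q≢q₀ → agree p₀ q (q≢q₀ ∘ proj₂))
  regroup : ∀ a y d c → (a + y) + (d + c) ≡ (a + d) + (c + y)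
  regroup = solve-∀
  regroup′ : ∀ a y d c → (a + d) + (c + y) ≡ (a + y) + (c + d)
  regroup′ = solve-∀

twoL : ∀ {n} → Permutation′ n → ℕ
twoL π = len π + twoCycles π

module _ {n : ℕ} where

  ⟨$⟩ʳ-injective : (w : Permutation′ n) {x y : Fin n} → w ⟨$⟩ʳ x ≡ w ⟨$⟩ʳ y → x ≡ y
  ⟨$⟩ʳ-injective w e = trans (sym (inverseˡ w)) (trans (cong (w ⟨$⟩ˡ_) e) (inverseˡ w))

  ⟨$⟩ˡ-injective : (w : Permutation′ n) {x y : Fin n} → w ⟨$⟩ˡ x ≡ w ⟨$⟩ˡ y → x ≡ y
  ⟨$⟩ˡ-injective w e = trans (sym (inverseʳ w)) (trans (cong (w ⟨$⟩ʳ_) e) (inverseʳ w))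

  ⟨$⟩ʳ≡⇒⟨$⟩ˡ≡ : (w : Permutation′ n) {x y : Fin n} → w ⟨$⟩ʳ x ≡ y → x ≡ w ⟨$⟩ˡ y
  ⟨$⟩ʳ≡⇒⟨$⟩ˡ≡ w e = trans (sym (inverseˡ w)) (cong (w ⟨$⟩ˡ_) e)

  ⟨$⟩ˡ-cong : (v w : Permutation′ n) → v ≈ w → ∀ y → v ⟨$⟩ˡ y ≡ w ⟨$⟩ˡ y
  ⟨$⟩ˡ-cong v w v≈w y = sym (⟨$⟩ʳ≡⇒⟨$⟩ˡ≡ v (trans (v≈w (w ⟨$⟩ˡ y)) (inverseʳ w)))

  IsInvolution-cong : (ρ π : Permutation′ n) → ρ ≈ π → IsInvolution π → IsInvolution ρ
  IsInvolution-cong ρ π ρ≈π inv x = trans (ρ≈π (ρ ⟨$⟩ʳ x)) (trans (cong (π ⟨$⟩ʳ_) (ρ≈π x)) (inv x))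

  involution-⟨$⟩ˡ : (π : Permutation′ n) → IsInvolution π → ∀ x → π ⟨$⟩ˡ x ≡ π ⟨$⟩ʳ x
  involution-⟨$⟩ˡ π inv x = sym (⟨$⟩ʳ≡⇒⟨$⟩ˡ≡ π (inv x))

  len-cong : (v w : Permutation′ n) → v ≈ w → len v ≡ len w
  len-cong v w v≈w = begin
    len v                        ≡⟨ len≡∑²inversion v ⟩
    ∑² (inversion (v ⟨$⟩ʳ_))     ≡⟨ sum-cong-≗ (λ p → sum-cong-≗ (λ q →
                                      inversion-agree (v ⟨$⟩ʳ_) (w ⟨$⟩ʳ_) p q (λ _ →
                                        cong₂ (λ a b → does (a <? b)) (v≈w q) (v≈w p)))) ⟩
    ∑² (inversion (w ⟨$⟩ʳ_))     ≡⟨ sym (len≡∑²inversion w) ⟩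
    len w                        ∎
    where open ≡-Reasoning

  twoCycles-cong : (v w : Permutation′ n) → v ≈ w → twoCycles v ≡ twoCycles w
  twoCycles-cong v w v≈w = begin
    twoCycles v                  ≡⟨ twoCycles≡∑excedance v ⟩
    sum (excedance (v ⟨$⟩ʳ_))    ≡⟨ sum-cong-≗ (λ a → cong (λ b → indicator (does (a <? b))) (v≈w a)) ⟩
    sum (excedance (w ⟨$⟩ʳ_))    ≡⟨ sym (twoCycles≡∑excedance w) ⟩
    twoCycles w                  ∎
    where open ≡-Reasoning

  twoL-cong : (v w : Permutation′ n) → v ≈ w → twoL v ≡ twoL w
  twoL-cong v w v≈w = cong₂ _+_ (len-cong v w v≈w) (twoCycles-cong v w v≈w)

  len≡0 : (w : Permutation′ n) → w ≈ idₚ → len w ≡ 0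
  len≡0 w w≈id = trans (len≡∑²inversion w) (sum≡0 _ (λ p → sum≡0 _ (λ q → no-inversion p q (p <? q))))
    where
    no-inversion : ∀ p q → Dec (p < q) → inversion (w ⟨$⟩ʳ_) p q ≡ 0
    no-inversion p q (no p≮q) = indicator-∧-noˡ (p <? q) (w ⟨$⟩ʳ q <? w ⟨$⟩ʳ p) p≮q
    no-inversion p q (yes p<q) = indicator-∧-noʳ (p <? q) (w ⟨$⟩ʳ q <? w ⟨$⟩ʳ p)
                                   (λ wq<wp → <-asym p<q (subst₂ _<_ (w≈id q) (w≈id p) wq<wp))

  twoCycles≡0 : (w : Permutation′ n) → w ≈ idₚ → twoCycles w ≡ 0
  twoCycles≡0 w w≈id = trans (twoCycles≡∑excedance w) (sum≡0 _ no-excedance)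
    where
    no-excedance : ∀ a → excedance (w ⟨$⟩ʳ_) a ≡ 0
    no-excedance a rewrite w≈id a | dec-false (a <? a) (<-irrefl refl) = refl

module _ {n : ℕ} where

  <-resp⁻ : {a a′ b b′ : Fin n} → a ≡ a′ → b ≡ b′ → a′ < b′ → a < b
  <-resp⁻ refl refl a<b = a<b

  <-cycle₃ : {a b c : Fin n} → a < b → b < c → c < a → ⊥
  <-cycle₃ a<b b<c = <-asym (<-trans a<b b<c)

  <-cycle₄ : {a b c d : Fin n} → a < b → b < c → c < d → d < a → ⊥
  <-cycle₄ a<b b<c = <-cycle₃ (<-trans a<b b<c)

  injective-≮⇒> : (p : Fin n → Fin n) → (∀ {x y} → p x ≡ p y → x ≡ y) →
                  ∀ {x y} → x ≢ y → ¬ (p x < p y) → p y < p x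
  injective-≮⇒> p p-inj {x} {y} x≢y px≮py with <-cmp (p x) (p y)
  ... | tri< px<py _ _ = ⊥-elim (px≮py px<py)
  ... | tri≈ _ px≡py _ = ⊥-elim (x≢y (p-inj px≡py))
  ... | tri> _ _ py<px = py<px

-- Conditions (1)–(5) with the order on labels replaced by R, the involution by f and
-- w⁻¹ by pos; Conditions π w is Conditionsᴿ _<_ (π ⟨$⟩ʳ_) (w ⟨$⟩ˡ_) by definition.
-- Relabelling by an adjacent transposition replaces _<_ by a different order.
module _ {n : ℕ} (R : Fin n → Fin n → Set) (f pos : Fin n → Fin n) where

  Condition₁ Condition₂ Condition₃ Condition₄ Condition₅ Conditionsᴿ : Set
  Condition₁ = ∀ a b → R a b × f a ≡ b →
    (pos b < pos a) × (∀ (x : Fin n) → R a x → R x b → ¬ ((pos b < pos x) × (pos x < pos a)))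
  Condition₂ = ∀ a b a′ b′ → R a b × f a ≡ b → R a′ b′ × f a′ ≡ b′ → R a a′ → R b b′ → pos a < pos b′
  Condition₃ = ∀ c c′ → f c ≡ c → f c′ ≡ c′ → R c c′ → pos c < pos c′
  Condition₄ = ∀ a b c → R a b × f a ≡ b → f c ≡ c → R c a → pos c < pos b
  Condition₅ = ∀ a b c → R a b × f a ≡ b → f c ≡ c → R b c → pos a < pos c
  Conditionsᴿ = Condition₁ × Condition₂ × Condition₃ × Condition₄ × Condition₅

module _ {n : ℕ} {R : Fin n → Fin n → Set} where

  Conditionsᴿ-cong : {f f′ pos pos′ : Fin n → Fin n} → (∀ x → f x ≡ f′ x) → (∀ x → pos x ≡ pos′ x) →
                     Conditionsᴿ R f pos → Conditionsᴿ R f′ pos′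
  Conditionsᴿ-cong {f} {f′} {pos} {pos′} f≗f′ pos≗pos′ (c₁ , c₂ , c₃ , c₄ , c₅) =
      (λ a b (r , e) → let (ba , between) = c₁ a b (r , fa e) in
         <-resp⁻ (sym (p b)) (sym (p a)) ba ,
         λ x r₁ r₂ (h₁ , h₂) → between x r₁ r₂ (<-resp⁻ (p b) (p x) h₁ , <-resp⁻ (p x) (p a) h₂))
    , (λ a b a′ b′ (r , e) (r′ , e′) ra rb →
         <-resp⁻ (sym (p a)) (sym (p b′)) (c₂ a b a′ b′ (r , fa e) (r′ , fa e′) ra rb))
    , (λ c c′ e e′ r → <-resp⁻ (sym (p c)) (sym (p c′)) (c₃ c c′ (fa e) (fa e′) r))
    , (λ a b c (r , e) e′ r′ → <-resp⁻ (sym (p c)) (sym (p b)) (c₄ a b c (r , fa e) (fa e′) r′))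
    , (λ a b c (r , e) e′ r′ → <-resp⁻ (sym (p a)) (sym (p c)) (c₅ a b c (r , fa e) (fa e′) r′))
    where
    fa : ∀ {a b} → f′ a ≡ b → f a ≡ b
    fa {a} = trans (f≗f′ a)
    p = pos≗pos′

  Conditionsᴿ-antimono : {R′ : Fin n → Fin n → Set} {f pos : Fin n → Fin n} → (∀ x y → R′ x y → R x y) →
                         Conditionsᴿ R f pos → Conditionsᴿ R′ f pos
  Conditionsᴿ-antimono R′⊆R (c₁ , c₂ , c₃ , c₄ , c₅) =
      (λ a b (r , e) → let (ba , between) = c₁ a b (R′⊆R a b r , e) in
         ba , λ x r₁ r₂ → between x (R′⊆R a x r₁) (R′⊆R x b r₂))
    , (λ a b a′ b′ (r , e) (r′ , e′) ra rb →
         c₂ a b a′ b′ (R′⊆R a b r , e) (R′⊆R a′ b′ r′ , e′) (R′⊆R a a′ ra) (R′⊆R b b′ rb))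
    , (λ c c′ e e′ r → c₃ c c′ e e′ (R′⊆R c c′ r))
    , (λ a b c (r , e) e′ r′ → c₄ a b c (R′⊆R a b r , e) e′ (R′⊆R c a r′))
    , (λ a b c (r , e) e′ r′ → c₅ a b c (R′⊆R a b r , e) e′ (R′⊆R b c r′))

  Conditionsᴿ-relabel : {f pos : Fin n → Fin n} (σ : Fin n → Fin n) → (∀ x → σ (σ x) ≡ x) →
    Conditionsᴿ R f pos → Conditionsᴿ (λ x y → R (σ x) (σ y)) (λ x → σ (f (σ x))) (pos ∘ σ)
  Conditionsᴿ-relabel {f} σ σσ (c₁ , c₂ , c₃ , c₄ , c₅) =
      (λ a b (r , e) → let (ba , between) = c₁ (σ a) (σ b) (r , fσ e) in ba , λ x → between (σ x))
    , (λ a b a′ b′ (r , e) (r′ , e′) → c₂ (σ a) (σ b) (σ a′) (σ b′) (r , fσ e) (r′ , fσ e′))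
    , (λ c c′ e e′ → c₃ (σ c) (σ c′) (fσ e) (fσ e′))
    , (λ a b c (r , e) e′ → c₄ (σ a) (σ b) (σ c) (r , fσ e) (fσ e′))
    , (λ a b c (r , e) e′ → c₅ (σ a) (σ b) (σ c) (r , fσ e) (fσ e′))
    where
    fσ : ∀ {a b} → σ (f (σ a)) ≡ b → f (σ a) ≡ σ b
    fσ {a} e = trans (sym (σσ (f (σ a)))) (cong σ e)

Conditions-id : ∀ {n} → Conditionsᴿ {n} _<_ (λ x → x) (λ x → x)
Conditions-id =
    (λ a b (a<b , a≡b) → ⊥-elim (<-irrefl a≡b a<b))
  , (λ a b _ _ (a<b , a≡b) _ _ _ → ⊥-elim (<-irrefl a≡b a<b))
  , (λ _ _ _ _ c<c′ → c<c′)
  , (λ a b _ (a<b , a≡b) _ _ → ⊥-elim (<-irrefl a≡b a<b))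
  , (λ a b _ (a<b , a≡b) _ _ → ⊥-elim (<-irrefl a≡b a<b))

Conditions-sorted⇒fixed : ∀ {n} (f : Fin n → Fin n) → (∀ x → f (f x) ≡ x) →
                          Conditionsᴿ _<_ f (λ x → x) → ∀ a → f a ≡ a
Conditions-sorted⇒fixed f f-inv (c₁ , _) a with <-cmp a (f a)
... | tri< a<fa _ _ = ⊥-elim (<-asym a<fa (proj₁ (c₁ a (f a) (a<fa , refl))))
... | tri≈ _ a≡fa _ = sym a≡fa
... | tri> _ _ fa<a = ⊥-elim (<-asym fa<a (proj₁ (c₁ (f a) a (fa<a , f-inv a))))

-- The adjacent transposition s k = (i j)

module Adjacent {m : ℕ} (k : Fin m) where

  X : Set
  X = Fin (suc m)

  i j : X
  i = inject₁ k
  j = fsuc k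

  σ : X → X
  σ = PC.transpose i j

  i<j : i < j
  i<j rewrite toℕ-inject₁ k = ℕ.≤-refl

  i≢j : i ≢ j
  i≢j i≡j = <-irrefl i≡j i<j

  j≮i : ¬ (j < i)
  j≮i = <-asym i<j

  i<x⇒j≤x : ∀ {x : X} → i < x → toℕ j ℕ.≤ toℕ x
  i<x⇒j≤x {x} i<x rewrite sym (toℕ-inject₁ k) = i<x

  i<x⇒j<x : ∀ {x : X} → x ≢ j → i < x → j < x
  i<x⇒j<x {x} x≢j i<x = ℕ.≤∧≢⇒< (i<x⇒j≤x i<x) (λ j≡x → x≢j (toℕ-injective (sym j≡x)))

  x<j⇒x<i : ∀ {x : X} → x ≢ i → x < j → x < i
  x<j⇒x<i {x} x≢i x<j with <-cmp x i
  ... | tri< x<i _ _ = x<i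
  ... | tri≈ _ x≡i _ = ⊥-elim (x≢i x≡i)
  ... | tri> _ _ i<x = ⊥-elim (ℕ.<⇒≱ x<j (i<x⇒j≤x i<x))

  nothing-between : ∀ {x : X} → i < x → x < j → ⊥
  nothing-between i<x x<j = ℕ.<⇒≱ x<j (i<x⇒j≤x i<x)

  data Spot (x : X) : Set where
    at-i  : x ≡ i → Spot x
    at-j  : x ≡ j → Spot x
    other : x ≢ i → x ≢ j → Spot x

  spot : ∀ x → Spot x
  spot x with x ≟ i | x ≟ j
  ... | yes x≡i | _       = at-i x≡i
  ... | no _    | yes x≡j = at-j x≡j
  ... | no x≢i  | no x≢j  = other x≢i x≢j

  σi : σ i ≡ j
  σi rewrite dec-true (i ≟ i) refl = refl

  σj : σ j ≡ i
  σj rewrite dec-false (j ≟ i) (i≢j ∘ sym) | dec-true (j ≟ j) refl = refl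

  σ-other : ∀ {x : X} → x ≢ i → x ≢ j → σ x ≡ x
  σ-other {x} x≢i x≢j rewrite dec-false (x ≟ i) x≢i | dec-false (x ≟ j) x≢j = refl

  σ-involutive : ∀ x → σ (σ x) ≡ x
  σ-involutive x with spot x
  ... | at-i refl = trans (cong σ σi) σj
  ... | at-j refl = trans (cong σ σj) σi
  ... | other x≢i x≢j = trans (cong σ (σ-other x≢i x≢j)) (σ-other x≢i x≢j)

  σ-injective : ∀ {x y : X} → σ x ≡ σ y → x ≡ y
  σ-injective {x} {y} e = trans (sym (σ-involutive x)) (trans (cong σ e) (σ-involutive y))

  σ-flip : ∀ x → PC.transpose j i x ≡ σ x
  σ-flip x = trans (sym (σ-involutive (PC.transpose j i x))) (cong σ (PC.transpose-inverse i j {x}))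

  σ-monotone : ∀ {x y : X} → x < y → ¬ (x ≡ i × y ≡ j) → σ x < σ y
  σ-monotone {x} {y} x<y not-ij with spot x | spot y
  ... | at-i refl | at-i refl = ⊥-elim (<-irrefl refl x<y)
  ... | at-i refl | at-j refl = ⊥-elim (not-ij (refl , refl))
  ... | at-i refl | other _ y≢j rewrite σi | σ-other (λ y≡i → <-irrefl (sym y≡i) x<y) y≢j = i<x⇒j<x y≢j x<y
  ... | at-j refl | at-i refl = ⊥-elim (j≮i x<y)
  ... | at-j refl | at-j refl = ⊥-elim (<-irrefl refl x<y)
  ... | at-j refl | other y≢i y≢j rewrite σj | σ-other y≢i y≢j = <-trans i<j x<y
  ... | other x≢i x≢j | at-i refl rewrite σ-other x≢i x≢j | σi = <-trans x<y i<j
  ... | other x≢i x≢j | at-j refl rewrite σ-other x≢i x≢j | σj = x<j⇒x<i x≢i x<y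
  ... | other x≢i x≢j | other y≢i y≢j rewrite σ-other x≢i x≢j | σ-other y≢i y≢j = x<y

  σ-reflects : ∀ {x y : X} → σ x < σ y → ¬ (x ≡ j × y ≡ i) → x < y
  σ-reflects {x} {y} σx<σy not-ji =
    subst₂ _<_ (σ-involutive x) (σ-involutive y)
      (σ-monotone σx<σy (λ (σx≡i , σy≡j) →
        not-ji (σ-injective (trans σx≡i (sym σj)) , σ-injective (trans σy≡j (sym σi)))))

  does-<?-σ : ∀ x y → ¬ (x ≡ i × y ≡ j) → ¬ (x ≡ j × y ≡ i) → does (x <? y) ≡ does (σ x <? σ y)
  does-<?-σ x y not-ij not-ji =
    does-⇔ (mk⇔ (λ x<y → σ-monotone x<y not-ij) (λ σx<σy → σ-reflects σx<σy not-ji)) (x <? y) (σ x <? σ y)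

  reindex-σ : (G : X → X → ℕ) → ∑² G ≡ ∑² (λ p q → G (σ p) (σ q))
  reindex-σ G = trans (sum-permute (λ p → sum (G p)) (s k)) (sum-cong-≗ (λ p → sum-permute (G (σ p)) (s k)))

  s·-⟨$⟩ˡ : (w : Permutation′ (suc m)) → ∀ x → (s k · w) ⟨$⟩ˡ x ≡ w ⟨$⟩ˡ σ x
  s·-⟨$⟩ˡ w x = cong (w ⟨$⟩ˡ_) (σ-flip x)

  s·-⟨$⟩ˡ-i : (w : Permutation′ (suc m)) → (s k · w) ⟨$⟩ˡ i ≡ w ⟨$⟩ˡ j
  s·-⟨$⟩ˡ-i w = trans (s·-⟨$⟩ˡ w i) (cong (w ⟨$⟩ˡ_) σi)

  s·-⟨$⟩ˡ-j : (w : Permutation′ (suc m)) → (s k · w) ⟨$⟩ˡ j ≡ w ⟨$⟩ˡ i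
  s·-⟨$⟩ˡ-j w = trans (s·-⟨$⟩ˡ w j) (cong (w ⟨$⟩ˡ_) σj)

  s·s·≈ : (w : Permutation′ (suc m)) → s k · (s k · w) ≈ w
  s·s·≈ w x = σ-involutive (w ⟨$⟩ʳ x)

  ·s·s≈ : (w : Permutation′ (suc m)) → (w · s k) · s k ≈ w
  ·s·s≈ w x = cong (w ⟨$⟩ʳ_) (σ-involutive x)

  -- The inversion sets of w and s k · w differ exactly in the pair of positions of i and j.
  len-s·-ascent : (w : Permutation′ (suc m)) → w ⟨$⟩ˡ i < w ⟨$⟩ˡ j → len (s k · w) ≡ suc (len w)
  len-s·-ascent w P<Q = begin
      len (s k · w)        ≡⟨ len≡∑²inversion (s k · w) ⟩
      ∑² G                 ≡⟨ sym (ℕ.+-identityʳ _) ⟩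
      ∑² G + 0             ≡⟨ cong (∑² G +_) (sym F-PQ) ⟩
      ∑² G + F P Q         ≡⟨ sym (∑²-agree-off F G P Q agree) ⟩
      ∑² F + G P Q         ≡⟨ cong₂ _+_ (sym (len≡∑²inversion w)) G-PQ ⟩
      len w + 1            ≡⟨ ℕ.+-comm (len w) 1 ⟩
      suc (len w)          ∎
    where
    open ≡-Reasoning
    P = w ⟨$⟩ˡ i
    Q = w ⟨$⟩ˡ j
    F G : X → X → ℕ
    F = inversion (w ⟨$⟩ʳ_)
    G = inversion (σ ∘ (w ⟨$⟩ʳ_))
    wP≡i : w ⟨$⟩ʳ P ≡ i
    wP≡i = inverseʳ w
    wQ≡j : w ⟨$⟩ʳ Q ≡ j
    wQ≡j = inverseʳ w
    agree : ∀ p q → ¬ (p ≡ P × q ≡ Q) → F p q ≡ G p q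
    agree p q not-PQ = inversion-agree (w ⟨$⟩ʳ_) (σ ∘ (w ⟨$⟩ʳ_)) p q (λ p<q →
      does-<?-σ (w ⟨$⟩ʳ q) (w ⟨$⟩ʳ p)
        (λ (wq≡i , wp≡j) → <-asym P<Q (subst₂ _<_ (⟨$⟩ʳ≡⇒⟨$⟩ˡ≡ w wp≡j) (⟨$⟩ʳ≡⇒⟨$⟩ˡ≡ w wq≡i) p<q))
        (λ (wq≡j , wp≡i) → not-PQ (⟨$⟩ʳ≡⇒⟨$⟩ˡ≡ w wp≡i , ⟨$⟩ʳ≡⇒⟨$⟩ˡ≡ w wq≡j)))
    F-PQ : F P Q ≡ 0
    F-PQ = indicator-∧-noʳ (P <? Q) (w ⟨$⟩ʳ Q <? w ⟨$⟩ʳ P) (λ wQ<wP → j≮i (subst₂ _<_ wQ≡j wP≡i wQ<wP))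
    G-PQ : G P Q ≡ 1
    G-PQ = indicator-∧-yes (P <? Q) (σ (w ⟨$⟩ʳ Q) <? σ (w ⟨$⟩ʳ P)) P<Q
             (subst₂ _<_ (sym (trans (cong σ wQ≡j) σj)) (sym (trans (cong σ wP≡i) σi)) i<j)

  len-s·-descent : (w : Permutation′ (suc m)) → w ⟨$⟩ˡ j < w ⟨$⟩ˡ i → len w ≡ suc (len (s k · w))
  len-s·-descent w Q<P = begin
      len w                    ≡⟨ len-cong w (s k · (s k · w)) (λ x → sym (s·s·≈ w x)) ⟩
      len (s k · (s k · w))    ≡⟨ len-s·-ascent (s k · w) (<-resp⁻ (s·-⟨$⟩ˡ-i w) (s·-⟨$⟩ˡ-j w) Q<P) ⟩
      suc (len (s k · w))      ∎
    where open ≡-Reasoning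

  len-s·≤ : (w : Permutation′ (suc m)) → len (s k · w) ℕ.≤ suc (len w)
  len-s·≤ w with <-cmp (w ⟨$⟩ˡ i) (w ⟨$⟩ˡ j)
  ... | tri< P<Q _ _ = ℕ.≤-reflexive (len-s·-ascent w P<Q)
  ... | tri≈ _ P≡Q _ = ⊥-elim (i≢j (⟨$⟩ˡ-injective w P≡Q))
  ... | tri> _ _ Q<P = ℕ.≤-trans (ℕ.n≤1+n _) (ℕ.≤-trans
                         (ℕ.≤-reflexive (sym (len-s·-descent w Q<P))) (ℕ.n≤1+n _))

  -- Reindexing the double sum by σ turns the inversions of w · s k into those of w,
  -- except at the pair (j , i).
  len-·s-ascent : (w : Permutation′ (suc m)) → w ⟨$⟩ʳ i < w ⟨$⟩ʳ j → len (w · s k) ≡ suc (len w)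
  len-·s-ascent w wi<wj = begin
      len (w · s k)        ≡⟨ len≡∑²inversion (w · s k) ⟩
      ∑² G                 ≡⟨ reindex-σ G ⟩
      ∑² H                 ≡⟨ sym (ℕ.+-identityʳ _) ⟩
      ∑² H + 0             ≡⟨ cong (∑² H +_) (sym F-ji) ⟩
      ∑² H + F j i         ≡⟨ ∑²-agree-off H F j i agree ⟩
      ∑² F + H j i         ≡⟨ cong₂ _+_ (sym (len≡∑²inversion w)) H-ji ⟩
      len w + 1            ≡⟨ ℕ.+-comm (len w) 1 ⟩
      suc (len w)          ∎
    where
    open ≡-Reasoning
    F G H : X → X → ℕ
    F = inversion (w ⟨$⟩ʳ_)
    G = inversion ((w ⟨$⟩ʳ_) ∘ σ)
    H p q = G (σ p) (σ q)
    H≡ : ∀ p q → H p q ≡ indicator (does (σ p <? σ q) ∧ does (w ⟨$⟩ʳ q <? w ⟨$⟩ʳ p))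
    H≡ p q = cong₂ (λ a b → indicator (does (σ p <? σ q) ∧ does (w ⟨$⟩ʳ a <? w ⟨$⟩ʳ b)))
                   (σ-involutive q) (σ-involutive p)
    agree : ∀ p q → ¬ (p ≡ j × q ≡ i) → H p q ≡ F p q
    agree p q not-ji = agree′ p q not-ji (p ≟ i) (q ≟ j)
      where
      agree′ : ∀ p q → ¬ (p ≡ j × q ≡ i) → Dec (p ≡ i) → Dec (q ≡ j) → H p q ≡ F p q
      agree′ p q _ (yes refl) (yes refl) =
        trans (H≡ i j) (trans (indicator-∧-noˡ (σ i <? σ j) (w ⟨$⟩ʳ j <? w ⟨$⟩ʳ i)
                                 (λ σi<σj → j≮i (subst₂ _<_ σi σj σi<σj)))
                              (sym (indicator-∧-noʳ (i <? j) (w ⟨$⟩ʳ j <? w ⟨$⟩ʳ i) (<-asym wi<wj))))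
      agree′ p q not-ji (no p≢i) _ =
        trans (H≡ p q) (cong (λ b → indicator (b ∧ does (w ⟨$⟩ʳ q <? w ⟨$⟩ʳ p)))
                             (sym (does-<?-σ p q (p≢i ∘ proj₁) not-ji)))
      agree′ p q not-ji (yes _) (no q≢j) =
        trans (H≡ p q) (cong (λ b → indicator (b ∧ does (w ⟨$⟩ʳ q <? w ⟨$⟩ʳ p)))
                             (sym (does-<?-σ p q (q≢j ∘ proj₂) not-ji)))
    F-ji : F j i ≡ 0
    F-ji = indicator-∧-noˡ (j <? i) (w ⟨$⟩ʳ i <? w ⟨$⟩ʳ j) j≮i
    H-ji : H j i ≡ 1
    H-ji = trans (H≡ j i) (indicator-∧-yes (σ j <? σ i) (w ⟨$⟩ʳ i <? w ⟨$⟩ʳ j)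
                                           (subst₂ _<_ (sym σj) (sym σi) i<j) wi<wj)

  len-·s-descent : (w : Permutation′ (suc m)) → w ⟨$⟩ʳ j < w ⟨$⟩ʳ i → len w ≡ suc (len (w · s k))
  len-·s-descent w wj<wi = begin
      len w                    ≡⟨ len-cong w ((w · s k) · s k) (λ x → sym (·s·s≈ w x)) ⟩
      len ((w · s k) · s k)    ≡⟨ len-·s-ascent (w · s k)
                                    (subst₂ _<_ (sym (cong (w ⟨$⟩ʳ_) σi)) (sym (cong (w ⟨$⟩ʳ_) σj)) wj<wi) ⟩
      suc (len (w · s k))      ∎
    where open ≡-Reasoning

  BothFixed : (X → X) → Set
  BothFixed f = (f i ≡ i) × (f j ≡ j)

  BothFixed-resp : ∀ {f g : X → X} → (∀ x → f x ≡ g x) → BothFixed f → BothFixed g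
  BothFixed-resp f≗g (fi≡i , fj≡j) = trans (sym (f≗g i)) fi≡i , trans (sym (f≗g j)) fj≡j

  conj-⟨$⟩ˡ : (π : Permutation′ (suc m)) → IsInvolution π → ∀ x → (π · s k) ⟨$⟩ˡ x ≡ σ (π ⟨$⟩ʳ x)
  conj-⟨$⟩ˡ π inv x = trans (σ-flip (π ⟨$⟩ˡ x)) (cong σ (involution-⟨$⟩ˡ π inv x))

  conj-involution : (π : Permutation′ (suc m)) → IsInvolution π → IsInvolution (s k · (π · s k))
  conj-involution π inv x =
    trans (cong (λ t → σ (π ⟨$⟩ʳ t)) (σ-involutive (π ⟨$⟩ʳ σ x)))
          (trans (cong σ (inv (σ x))) (σ-involutive x))

  conj-fixed≈ : (π : Permutation′ (suc m)) → BothFixed (π ⟨$⟩ʳ_) → s k · (π · s k) ≈ π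
  conj-fixed≈ π (πi≡i , πj≡j) x with spot x
  ... | at-i refl = trans (cong (λ t → σ (π ⟨$⟩ʳ t)) σi) (trans (cong σ πj≡j) (trans σj (sym πi≡i)))
  ... | at-j refl = trans (cong (λ t → σ (π ⟨$⟩ʳ t)) σj) (trans (cong σ πi≡i) (trans σi (sym πj≡j)))
  ... | other x≢i x≢j = trans (cong (λ t → σ (π ⟨$⟩ʳ t)) (σ-other x≢i x≢j))
                          (σ-other (x≢i ∘ ⟨$⟩ʳ-injective π ∘ (λ e → trans e (sym πi≡i)))
                                   (x≢j ∘ ⟨$⟩ʳ-injective π ∘ (λ e → trans e (sym πj≡j))))

  len-conj-ascent : (π : Permutation′ (suc m)) → IsInvolution π →
                    π ⟨$⟩ʳ i < π ⟨$⟩ʳ j → ¬ BothFixed (π ⟨$⟩ʳ_) →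
                    len (s k · (π · s k)) ≡ suc (suc (len π))
  len-conj-ascent π inv πi<πj not-fixed =
    trans (len-s·-ascent (π · s k) (subst₂ _<_ (sym (conj-⟨$⟩ˡ π inv i)) (sym (conj-⟨$⟩ˡ π inv j))
                                      (σ-monotone πi<πj not-fixed)))
          (cong suc (len-·s-ascent π πi<πj))

  len-conj≡2+⇒ascent : (π : Permutation′ (suc m)) → len (s k · (π · s k)) ≡ suc (suc (len π)) →
                       π ⟨$⟩ʳ i < π ⟨$⟩ʳ j × ¬ BothFixed (π ⟨$⟩ʳ_)
  len-conj≡2+⇒ascent π len≡ = πi<πj , not-fixed
    where
    not-fixed : ¬ BothFixed (π ⟨$⟩ʳ_)
    not-fixed fixed = ℕ.<-irrefl (trans (sym (len-cong (s k · (π · s k)) π (conj-fixed≈ π fixed))) len≡)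
                                 (ℕ.m<n⇒m<1+n (ℕ.n<1+n (len π)))
    πi<πj : π ⟨$⟩ʳ i < π ⟨$⟩ʳ j
    πi<πj with <-cmp (π ⟨$⟩ʳ i) (π ⟨$⟩ʳ j)
    ... | tri< πi<πj _ _ = πi<πj
    ... | tri≈ _ πi≡πj _ = ⊥-elim (i≢j (⟨$⟩ʳ-injective π πi≡πj))
    ... | tri> _ _ πj<πi = ⊥-elim (ℕ.1+n≰n (ℕ.≤-trans (ℕ.n≤1+n (suc (len π))) (begin
          suc (suc (len π))      ≡⟨ sym len≡ ⟩
          len (s k · (π · s k))  ≤⟨ len-s·≤ (π · s k) ⟩
          suc (len (π · s k))    ≡⟨ sym (len-·s-descent π πj<πi) ⟩
          len π                  ∎)))
      where open ℕ.≤-Reasoning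

  -- σ is monotone on every pair (a , π a) unless π swaps i and j.
  twoCycles-conj : (π : Permutation′ (suc m)) → IsInvolution π → π ⟨$⟩ʳ i ≢ j →
                   twoCycles (s k · (π · s k)) ≡ twoCycles π
  twoCycles-conj π inv πi≢j = begin
      twoCycles (s k · (π · s k))          ≡⟨ twoCycles≡∑excedance (s k · (π · s k)) ⟩
      sum (excedance f)                    ≡⟨ sum-permute (excedance f) (s k) ⟩
      sum (excedance f ∘ σ)                ≡⟨ sum-cong-≗ same ⟩
      sum (excedance (π ⟨$⟩ʳ_))            ≡⟨ sym (twoCycles≡∑excedance π) ⟩
      twoCycles π                          ∎
    where
    open ≡-Reasoning
    f : X → X
    f x = σ (π ⟨$⟩ʳ σ x)
    same : ∀ a → excedance f (σ a) ≡ excedance (π ⟨$⟩ʳ_) a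
    same a = trans (cong (λ t → indicator (does (σ a <? σ (π ⟨$⟩ʳ t)))) (σ-involutive a))
      (cong indicator (sym (does-<?-σ a (π ⟨$⟩ʳ a) (λ { (refl , πi≡j) → πi≢j πi≡j })
         (λ { (refl , πj≡i) → πi≢j (trans (cong (π ⟨$⟩ʳ_) (sym πj≡i)) (inv j)) }))))

  twoCycles-s·-fixed : (π : Permutation′ (suc m)) → BothFixed (π ⟨$⟩ʳ_) →
                       twoCycles (s k · π) ≡ suc (twoCycles π)
  twoCycles-s·-fixed π (πi≡i , πj≡j) = begin
      twoCycles (s k · π)        ≡⟨ sym (ℕ.+-identityʳ _) ⟩
      twoCycles (s k · π) + 0    ≡⟨ cong₂ _+_ (twoCycles≡∑excedance (s k · π)) (sym g-i) ⟩
      sum f + g i                ≡⟨ sum-agree-off f g i agree ⟩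
      sum g + f i                ≡⟨ cong₂ _+_ (sym (twoCycles≡∑excedance π)) f-i ⟩
      twoCycles π + 1            ≡⟨ ℕ.+-comm _ 1 ⟩
      suc (twoCycles π)          ∎
    where
    open ≡-Reasoning
    f g : X → ℕ
    f = excedance (σ ∘ (π ⟨$⟩ʳ_))
    g = excedance (π ⟨$⟩ʳ_)
    g-i : g i ≡ 0
    g-i rewrite πi≡i | dec-false (i <? i) (<-irrefl refl) = refl
    f-i : f i ≡ 1
    f-i rewrite πi≡i | σi | dec-true (i <? j) i<j = refl
    agree : ∀ x → x ≢ i → f x ≡ g x
    agree x x≢i = agree′ x x≢i (x ≟ j)
      where
      agree′ : ∀ x → x ≢ i → Dec (x ≡ j) → f x ≡ g x
      agree′ x _ (yes refl) rewrite πj≡j | σj | dec-false (j <? i) j≮i | dec-false (j <? j) (<-irrefl refl) = refl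
      agree′ x x≢i (no x≢j) = cong (λ t → indicator (does (x <? t)))
        (σ-other (x≢i ∘ ⟨$⟩ʳ-injective π ∘ (λ e → trans e (sym πi≡i)))
                 (x≢j ∘ ⟨$⟩ʳ-injective π ∘ (λ e → trans e (sym πj≡j))))

  len-s·-fixed : (π : Permutation′ (suc m)) → BothFixed (π ⟨$⟩ʳ_) → len (s k · π) ≡ suc (len π)
  len-s·-fixed π (πi≡i , πj≡j) =
    len-s·-ascent π (subst₂ _<_ (⟨$⟩ʳ≡⇒⟨$⟩ˡ≡ π πi≡i) (⟨$⟩ʳ≡⇒⟨$⟩ˡ≡ π πj≡j) i<j)

  -- Conditions under relabelling by σ

  _⊏_ : X → X → Set
  x ⊏ y = σ x < σ y

  j⊏i : j ⊏ i
  j⊏i = <-resp⁻ σj σi i<j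

  ⊏⇒< : ∀ {x y : X} → x ⊏ y → (x < y) ⊎ (x ≡ j × y ≡ i)
  ⊏⇒< {x} {y} x⊏y = go (x ≟ j) (y ≟ i)
    where
    go : Dec (x ≡ j) → Dec (y ≡ i) → (x < y) ⊎ (x ≡ j × y ≡ i)
    go (yes x≡j) (yes y≡i) = inj₂ (x≡j , y≡i)
    go (no x≢j) _ = inj₁ (σ-reflects x⊏y (x≢j ∘ proj₁))
    go (yes _) (no y≢i) = inj₁ (σ-reflects x⊏y (y≢i ∘ proj₂))

  <⇒⊏ : ∀ {x y : X} → x < y → (x ⊏ y) ⊎ (x ≡ i × y ≡ j)
  <⇒⊏ {x} {y} x<y = go (x ≟ i) (y ≟ j)
    where
    go : Dec (x ≡ i) → Dec (y ≡ j) → (x ⊏ y) ⊎ (x ≡ i × y ≡ j)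
    go (yes x≡i) (yes y≡j) = inj₂ (x≡i , y≡j)
    go (no x≢i) _ = inj₁ (σ-monotone x<y (x≢i ∘ proj₁))
    go (yes _) (no y≢j) = inj₁ (σ-monotone x<y (y≢j ∘ proj₂))

  module _ (f pos : X → X) (f-inv : ∀ x → f (f x) ≡ x) where

    private
      f-injective : ∀ {x y} → f x ≡ f y → x ≡ y
      f-injective {x} {y} e = trans (sym (f-inv x)) (trans (cong f e) (f-inv y))

      f-swap : ∀ {x y} → f x ≡ y → f y ≡ x
      f-swap {x} refl = f-inv x

    Conditions-<⇒⊏ : f i < f j → ¬ BothFixed f → Conditionsᴿ _<_ f pos → Conditionsᴿ _⊏_ f pos
    Conditions-<⇒⊏ fi<fj not-fixed (c₁ , c₂ , c₃ , c₄ , c₅) = c₁′ , c₂′ , c₃′ , c₄′ , c₅′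
      where
      fi≢j : f i ≢ j
      fi≢j fi≡j = j≮i (<-resp⁻ (sym fi≡j) (sym (f-swap fi≡j)) fi<fj)

      cycle⇒< : ∀ {a b} → a ⊏ b → f a ≡ b → a < b
      cycle⇒< a⊏b fa≡b with ⊏⇒< a⊏b
      ... | inj₁ a<b = a<b
      ... | inj₂ (refl , refl) = ⊥-elim (fi≢j (f-swap fa≡b))

      c₁′ : Condition₁ _⊏_ f pos
      c₁′ a b (a⊏b , fa≡b) = proj₁ (c₁ a b (a<b , fa≡b)) , not-between
        where
        a<b = cycle⇒< a⊏b fa≡b
        not-between : ∀ x → a ⊏ x → x ⊏ b → ¬ ((pos b < pos x) × (pos x < pos a))
        not-between x a⊏x x⊏b (h₁ , h₂) with ⊏⇒< a⊏x | ⊏⇒< x⊏b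
        ... | inj₁ a<x | inj₁ x<b = proj₂ (c₁ a b (a<b , fa≡b)) x a<x x<b (h₁ , h₂)
        ... | inj₂ (refl , refl) | inj₂ (i≡j , _) = i≢j i≡j
        ... | inj₂ (refl , refl) | inj₁ _ with spot (f i)
        ...   | at-i fi≡i = <-asym h₁ (c₄ j b i (a<b , fa≡b) fi≡i i<j)
        ...   | at-j fi≡j = fi≢j fi≡j
        ...   | other fi≢i _ with <-cmp i (f i)
        ...     | tri< i<fi _ _ =
                  <-asym h₁ (c₂ i (f i) j b (i<fi , refl) (a<b , fa≡b) i<j (<-resp⁻ refl (sym fa≡b) fi<fj))
        ...     | tri≈ _ i≡fi _ = fi≢i (sym i≡fi)
        ...     | tri> _ _ fi<i = <-cycle₃ (proj₁ (c₁ (f i) i (fi<i , f-inv i)))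
                                    (c₂ (f i) i j b (fi<i , f-inv i) (a<b , fa≡b) (<-trans fi<i i<j) (<-trans i<j a<b)) h₁
        not-between x a⊏x x⊏b (h₁ , h₂) | inj₁ a<x | inj₂ (refl , refl) with spot (f j)
        ... | at-j fj≡j = <-asym h₂ (c₅ a i j (a<b , fa≡b) fj≡j i<j)
        ... | at-i fj≡i = <-irrefl (sym (f-injective (trans fj≡i (sym fa≡b)))) a<x
        ... | other _ fj≢j with <-cmp j (f j)
        ...   | tri< j<fj _ _ = <-cycle₃ (c₂ a i j (f j) (a<b , fa≡b) (j<fj , refl) a<x (<-trans i<j j<fj))
                                  (proj₁ (c₁ j (f j) (j<fj , refl))) h₂
        ...   | tri≈ _ j≡fj _ = fj≢j (sym j≡fj)
        ...   | tri> _ _ fj<j = <-asym h₂ (c₂ a i (f j) j (a<b , fa≡b) (fj<j , f-inv j)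
                                  (<-resp⁻ (sym (f-swap fa≡b)) refl fi<fj) i<j)

      c₂′ : Condition₂ _⊏_ f pos
      c₂′ a b a′ b′ (a⊏b , fa≡b) (a′⊏b′ , fa′≡b′) a⊏a′ b⊏b′ with ⊏⇒< a⊏a′ | ⊏⇒< b⊏b′
      ... | inj₁ a<a′ | inj₁ b<b′ =
            c₂ a b a′ b′ (cycle⇒< a⊏b fa≡b , fa≡b) (cycle⇒< a′⊏b′ fa′≡b′ , fa′≡b′) a<a′ b<b′
      ... | inj₁ a<a′ | inj₂ (refl , refl) =
            ⊥-elim (<-asym a<a′ (<-resp⁻ (sym (f-swap fa′≡b′)) (sym (f-swap fa≡b)) fi<fj))
      ... | inj₂ (refl , refl) | inj₁ b<b′ = ⊥-elim (<-asym b<b′ (<-resp⁻ (sym fa′≡b′) (sym fa≡b) fi<fj))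
      ... | inj₂ (refl , refl) | inj₂ (refl , _) = ⊥-elim (<-irrefl refl (cycle⇒< a⊏b fa≡b))

      c₃′ : Condition₃ _⊏_ f pos
      c₃′ c c′ fc≡c fc′≡c′ c⊏c′ with ⊏⇒< c⊏c′
      ... | inj₁ c<c′ = c₃ c c′ fc≡c fc′≡c′ c<c′
      ... | inj₂ (refl , refl) = ⊥-elim (not-fixed (fc′≡c′ , fc≡c))

      c₄′ : Condition₄ _⊏_ f pos
      c₄′ a b c (a⊏b , fa≡b) fc≡c c⊏a with ⊏⇒< c⊏a
      ... | inj₁ c<a = c₄ a b c (cycle⇒< a⊏b fa≡b , fa≡b) fc≡c c<a
      ... | inj₂ (refl , refl) =
            ⊥-elim (nothing-between (cycle⇒< a⊏b fa≡b) (<-resp⁻ (sym fa≡b) (sym fc≡c) fi<fj))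

      c₅′ : Condition₅ _⊏_ f pos
      c₅′ a b c (a⊏b , fa≡b) fc≡c b⊏c with ⊏⇒< b⊏c
      ... | inj₁ b<c = c₅ a b c (cycle⇒< a⊏b fa≡b , fa≡b) fc≡c b<c
      ... | inj₂ (refl , refl) =
            ⊥-elim (nothing-between (<-resp⁻ (sym fc≡c) (sym (f-swap fa≡b)) fi<fj) (cycle⇒< a⊏b fa≡b))

    Conditions-⊏⇒not-fixed : pos i < pos j → Conditionsᴿ _⊏_ f pos → ¬ BothFixed f
    Conditions-⊏⇒not-fixed pi<pj (_ , _ , c₃ , _ , _) (fi≡i , fj≡j) = <-asym pi<pj (c₃ j i fj≡j fi≡i j⊏i)

    Conditions-⊏⇒< : (∀ {x y} → pos x ≡ pos y → x ≡ y) → pos i < pos j → f i ≢ j →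
                     Conditionsᴿ _⊏_ f pos → Conditionsᴿ _<_ f pos
    Conditions-⊏⇒< pos-inj pi<pj fi≢j cond@(c₁ , c₂ , c₃ , c₄ , c₅) = c₁′ , c₂′ , c₃′ , c₄′ , c₅′
      where
      cycle⇒⊏ : ∀ {a b} → a < b → f a ≡ b → a ⊏ b
      cycle⇒⊏ a<b fa≡b with <⇒⊏ a<b
      ... | inj₁ a⊏b = a⊏b
      ... | inj₂ (refl , refl) = ⊥-elim (fi≢j fa≡b)

      -- A cycle (a , b) through one of i, j whose other end lies beyond j (resp. before i)
      -- puts j (resp. i) between b and a, which condition (1) forbids.
      after-j : ∀ {b} → j < b → f j ≡ b → pos i < pos b
      after-j {b} j<b fj≡b = injective-≮⇒> pos pos-inj (λ b≡i → j≮i (<-resp⁻ refl (sym b≡i) j<b))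
        (λ pb<pi → proj₂ (c₁ j b (cycle⇒⊏ j<b fj≡b , fj≡b)) i j⊏i
          (σ-monotone (<-trans i<j j<b) (λ (_ , b≡j) → <-irrefl (sym b≡j) j<b)) (pb<pi , pi<pj))
      before-i : ∀ {a} → a < i → f a ≡ i → pos a < pos j
      before-i {a} a<i fa≡i = injective-≮⇒> pos pos-inj (λ j≡a → j≮i (<-resp⁻ j≡a refl a<i))
        (λ pj<pa → proj₂ (c₁ a i (cycle⇒⊏ a<i fa≡i , fa≡i)) j
          (σ-monotone (<-trans a<i i<j) (λ (a≡i , _) → <-irrefl a≡i a<i)) j⊏i (pi<pj , pj<pa))

      c₁′ : Condition₁ _<_ f pos
      c₁′ a b (a<b , fa≡b) = proj₁ (c₁ a b (cycle⇒⊏ a<b fa≡b , fa≡b)) , not-between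
        where
        not-between : ∀ x → a < x → x < b → ¬ ((pos b < pos x) × (pos x < pos a))
        not-between x a<x x<b (h₁ , h₂) with <⇒⊏ a<x | <⇒⊏ x<b
        ... | inj₁ a⊏x | inj₁ x⊏b = proj₂ (c₁ a b (cycle⇒⊏ a<b fa≡b , fa≡b)) x a⊏x x⊏b (h₁ , h₂)
        ... | inj₂ (refl , refl) | _ = <-asym h₂ pi<pj
        ... | inj₁ _ | inj₂ (refl , refl) = <-asym h₁ pi<pj

      c₂′ : Condition₂ _<_ f pos
      c₂′ a b a′ b′ (a<b , fa≡b) (a′<b′ , fa′≡b′) a<a′ b<b′ with <⇒⊏ a<a′ | <⇒⊏ b<b′
      ... | inj₂ (refl , refl) | _ = after-j a′<b′ fa′≡b′
      ... | inj₁ _ | inj₂ (refl , refl) = before-i a<b fa≡b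
      ... | inj₁ a⊏a′ | inj₁ b⊏b′ =
            c₂ a b a′ b′ (cycle⇒⊏ a<b fa≡b , fa≡b) (cycle⇒⊏ a′<b′ fa′≡b′ , fa′≡b′) a⊏a′ b⊏b′

      c₃′ : Condition₃ _<_ f pos
      c₃′ c c′ fc≡c fc′≡c′ c<c′ with <⇒⊏ c<c′
      ... | inj₁ c⊏c′ = c₃ c c′ fc≡c fc′≡c′ c⊏c′
      ... | inj₂ (refl , refl) = ⊥-elim (Conditions-⊏⇒not-fixed pi<pj cond (fc≡c , fc′≡c′))

      c₄′ : Condition₄ _<_ f pos
      c₄′ a b c (a<b , fa≡b) fc≡c c<a with <⇒⊏ c<a
      ... | inj₁ c⊏a = c₄ a b c (cycle⇒⊏ a<b fa≡b , fa≡b) fc≡c c⊏a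
      ... | inj₂ (refl , refl) = after-j a<b fa≡b

      c₅′ : Condition₅ _<_ f pos
      c₅′ a b c (a<b , fa≡b) fc≡c b<c with <⇒⊏ b<c
      ... | inj₁ b⊏c = c₅ a b c (cycle⇒⊏ a<b fa≡b , fa≡b) fc≡c b⊏c
      ... | inj₂ (refl , refl) = before-i a<b fa≡b

    Conditions-⊏⇒fi<fj : pos i < pos j → f i ≢ j → Conditionsᴿ _⊏_ f pos → f i < f j
    Conditions-⊏⇒fi<fj pi<pj fi≢j (c₁ , c₂ , _ , c₄ , c₅) with <-cmp (f i) (f j)
    ... | tri< fi<fj _ _ = fi<fj
    ... | tri≈ _ fi≡fj _ = ⊥-elim (i≢j (f-injective fi≡fj))
    ... | tri> _ _ fj<fi = ⊥-elim (descent fj<fi (spot (f i)) (spot (f j)))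
      where
      cycle-i : i ⊏ f i → pos (f i) < pos i
      cycle-i i⊏fi = proj₁ (c₁ i (f i) (i⊏fi , refl))
      cycle-j : f j ⊏ j → pos j < pos (f j)
      cycle-j fj⊏j = proj₁ (c₁ (f j) j (fj⊏j , f-inv j))

      descent : f j < f i → Spot (f i) → Spot (f j) → ⊥
      descent _ (at-j fi≡j) _ = fi≢j fi≡j
      descent fj<fi (at-i fi≡i) _ = <-cycle₃ pi<pj (cycle-j fj⊏j) (c₅ (f j) j i (fj⊏j , f-inv j) fi≡i j⊏i)
        where
        fj<i = <-resp⁻ refl (sym fi≡i) fj<fi
        fj⊏j = σ-monotone (<-trans fj<i i<j) (λ (fj≡i , _) → <-irrefl fj≡i fj<i)
      descent _ (other _ _) (at-i fj≡i) = fi≢j (f-swap fj≡i)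
      descent fj<fi (other _ fi≢j′) (at-j fj≡j) =
        <-cycle₃ pi<pj (c₄ i (f i) j (i⊏fi , refl) fj≡j j⊏i) (cycle-i i⊏fi)
        where
        j<fi = <-resp⁻ (sym fj≡j) refl fj<fi
        i⊏fi = σ-monotone (<-trans i<j j<fi) (fi≢j′ ∘ proj₂)
      descent fj<fi (other fi≢i fi≢j′) (other fj≢i fj≢j) with <-cmp i (f i) | <-cmp j (f j)
      ... | tri≈ _ i≡fi _ | _ = fi≢i (sym i≡fi)
      ... | _ | tri≈ _ j≡fj _ = fj≢j (sym j≡fj)
      ... | tri< i<fi _ _ | tri< j<fj _ _ =
            <-cycle₃ pi<pj (c₂ j (f j) i (f i) (j⊏fj , refl) (i⊏fi , refl) j⊏i fj⊏fi) (cycle-i i⊏fi)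
        where
        i⊏fi = σ-monotone i<fi (fi≢j′ ∘ proj₂)
        j⊏fj = σ-monotone j<fj (i≢j ∘ sym ∘ proj₁)
        fj⊏fi = σ-monotone fj<fi (fj≢i ∘ proj₁)
      ... | tri< i<fi _ _ | tri> _ _ fj<j =
            <-cycle₄ pi<pj (cycle-j fj⊏j) (c₂ (f j) j i (f i) (fj⊏j , f-inv j) (i⊏fi , refl) fj⊏i j⊏fi)
                     (cycle-i i⊏fi)
        where
        i⊏fi = σ-monotone i<fi (fi≢j′ ∘ proj₂)
        fj⊏j = σ-monotone fj<j (fj≢i ∘ proj₁)
        fj⊏i = σ-monotone (x<j⇒x<i fj≢i fj<j) (fj≢i ∘ proj₁)
        j⊏fi = σ-monotone (i<x⇒j<x fi≢j′ i<fi) (i≢j ∘ sym ∘ proj₁)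
      ... | tri> _ _ fi<i | tri< j<fj _ _ = <-asym (<-trans fj<fi (<-trans fi<i i<j)) j<fj
      ... | tri> _ _ fi<i | tri> _ _ fj<j =
            <-cycle₃ pi<pj (cycle-j fj⊏j) (c₂ (f j) j (f i) i (fj⊏j , f-inv j) (fi⊏i , f-inv i) fj⊏fi j⊏i)
        where
        fi⊏i = σ-monotone fi<i (fi≢i ∘ proj₁)
        fj⊏j = σ-monotone fj<j (fj≢i ∘ proj₁)
        fj⊏fi = σ-monotone fj<fi (fj≢i ∘ proj₁)

    pos-σ-other : ∀ {x} → x ≢ i → x ≢ j → pos (σ x) ≡ pos x
    pos-σ-other x≢i x≢j = cong pos (σ-other x≢i x≢j)

    -- In both cases below (i and j both fixed, or swapped) f maps {i , j} onto itself.
    module _ (f-keeps : ∀ {x} → x ≢ i → x ≢ j → f x ≢ i × f x ≢ j) where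

      σf-other : ∀ {a b} → a ≢ i → a ≢ j → σ (f a) ≡ b → f a ≡ b × b ≢ i × b ≢ j
      σf-other a≢i a≢j σfa≡b with f-keeps a≢i a≢j
      ... | fa≢i , fa≢j = fa≡b , (fa≢i ∘ trans fa≡b) , (fa≢j ∘ trans fa≡b)
        where fa≡b = trans (sym (σ-other fa≢i fa≢j)) σfa≡b

      cycle-off : Condition₁ _<_ f pos → ∀ {a b} → a ≢ i → a ≢ j → b ≢ i → b ≢ j → a < b → f a ≡ b →
        (pos (σ b) < pos (σ a)) × (∀ x → a < x → x < b → ¬ ((pos (σ b) < pos (σ x)) × (pos (σ x) < pos (σ a))))
      cycle-off c₁ {a} {b} a≢i a≢j b≢i b≢j a<b fa≡b =
        <-resp⁻ (pos-σ-other b≢i b≢j) (pos-σ-other a≢i a≢j) (proj₁ (c₁ a b (a<b , fa≡b))) , not-between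
        where
        between = proj₂ (c₁ a b (a<b , fa≡b))
        pσb = pos-σ-other b≢i b≢j
        pσa = pos-σ-other a≢i a≢j
        not-between : ∀ x → a < x → x < b → ¬ ((pos (σ b) < pos (σ x)) × (pos (σ x) < pos (σ a)))
        not-between x a<x x<b (h₁ , h₂) with spot x
        ... | at-i refl = between j (<-trans a<x i<j) (i<x⇒j<x b≢j x<b)
                            (<-resp⁻ (sym pσb) (sym (cong pos σi)) h₁ , <-resp⁻ (sym (cong pos σi)) (sym pσa) h₂)
        ... | at-j refl = between i (x<j⇒x<i a≢i a<x) (<-trans i<j x<b)
                            (<-resp⁻ (sym pσb) (sym (cong pos σj)) h₁ , <-resp⁻ (sym (cong pos σj)) (sym pσa) h₂)
        ... | other x≢i x≢j = between x a<x x<b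
                            (<-resp⁻ (sym pσb) (sym pσx) h₁ , <-resp⁻ (sym pσx) (sym pσa) h₂)
          where pσx = pos-σ-other x≢i x≢j

    Conditions-add-cycle : BothFixed f → pos i < pos j →
                           Conditionsᴿ _<_ f pos → Conditionsᴿ _<_ (σ ∘ f) (pos ∘ σ)
    Conditions-add-cycle (fi≡i , fj≡j) pi<pj (c₁ , c₂ , c₃ , c₄ , c₅) = c₁′ , c₂′ , c₃′ , c₄′ , c₅′
      where
      keeps : ∀ {x} → x ≢ i → x ≢ j → f x ≢ i × f x ≢ j
      keeps {x} x≢i x≢j = (λ fx≡i → x≢i (f-injective (trans fx≡i (sym fi≡i))))
                        , (λ fx≡j → x≢j (f-injective (trans fx≡j (sym fj≡j))))
      σfi≡j : σ (f i) ≡ j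
      σfi≡j = trans (cong σ fi≡i) σi
      σfj≡i : σ (f j) ≡ i
      σfj≡i = trans (cong σ fj≡j) σj
      no-cycle-from-j : ∀ {b} → j < b → σ (f j) ≡ b → ⊥
      no-cycle-from-j j<b σfj≡b = j≮i (<-resp⁻ refl (trans (sym σfj≡i) σfj≡b) j<b)
      fixed-other : ∀ {c} → σ (f c) ≡ c → c ≢ i × c ≢ j × f c ≡ c
      fixed-other {c} σfc≡c with spot c
      ... | at-i refl = ⊥-elim (i≢j (trans (sym σfc≡c) σfi≡j))
      ... | at-j refl = ⊥-elim (i≢j (trans (sym σfj≡i) σfc≡c))
      ... | other c≢i c≢j = c≢i , c≢j , proj₁ (σf-other keeps c≢i c≢j σfc≡c)
      pσi≡pj : pos (σ i) ≡ pos j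
      pσi≡pj = cong pos σi
      pσj≡pi : pos (σ j) ≡ pos i
      pσj≡pi = cong pos σj

      c₁′ : Condition₁ _<_ (σ ∘ f) (pos ∘ σ)
      c₁′ a b (a<b , σfa≡b) with spot a
      ... | at-i refl = <-resp⁻ (trans (cong (pos ∘ σ) b≡j) pσj≡pi) pσi≡pj pi<pj
                      , λ x i<x x<b _ → nothing-between i<x (<-resp⁻ refl (sym b≡j) x<b)
        where b≡j = trans (sym σfa≡b) σfi≡j
      ... | at-j refl = ⊥-elim (no-cycle-from-j a<b σfa≡b)
      ... | other a≢i a≢j with σf-other keeps a≢i a≢j σfa≡b
      ...   | fa≡b , b≢i , b≢j = cycle-off keeps c₁ a≢i a≢j b≢i b≢j a<b fa≡b

      c₂′ : Condition₂ _<_ (σ ∘ f) (pos ∘ σ)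
      c₂′ a b a′ b′ (a<b , σfa≡b) (a′<b′ , σfa′≡b′) a<a′ b<b′ with spot a | spot a′
      ... | at-i refl | at-i refl = ⊥-elim (<-irrefl refl a<a′)
      ... | _ | at-j refl = ⊥-elim (no-cycle-from-j a′<b′ σfa′≡b′)
      ... | at-j refl | _ = ⊥-elim (no-cycle-from-j a<b σfa≡b)
      ... | at-i refl | other a′≢i a′≢j with σf-other keeps a′≢i a′≢j σfa′≡b′
      ...   | fa′≡b′ , b′≢i , b′≢j =
              <-resp⁻ pσi≡pj (pos-σ-other b′≢i b′≢j)
                (c₄ a′ b′ j (a′<b′ , fa′≡b′) fj≡j (i<x⇒j<x a′≢j a<a′))
      c₂′ a b a′ b′ (a<b , σfa≡b) (a′<b′ , σfa′≡b′) a<a′ b<b′ | other a≢i a≢j | at-i refl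
        with σf-other keeps a≢i a≢j σfa≡b
      ...   | fa≡b , b≢i , _ = <-resp⁻ (pos-σ-other a≢i a≢j) (trans (cong (pos ∘ σ) b′≡j) pσj≡pi)
                                 (c₅ a b i (a<b , fa≡b) fi≡i (x<j⇒x<i b≢i (<-resp⁻ refl (sym b′≡j) b<b′)))
        where b′≡j = trans (sym σfa′≡b′) σfi≡j
      c₂′ a b a′ b′ (a<b , σfa≡b) (a′<b′ , σfa′≡b′) a<a′ b<b′ | other a≢i a≢j | other a′≢i a′≢j
        with σf-other keeps a≢i a≢j σfa≡b | σf-other keeps a′≢i a′≢j σfa′≡b′
      ...   | fa≡b , _ , _ | fa′≡b′ , b′≢i , b′≢j =
              <-resp⁻ (pos-σ-other a≢i a≢j) (pos-σ-other b′≢i b′≢j)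
                (c₂ a b a′ b′ (a<b , fa≡b) (a′<b′ , fa′≡b′) a<a′ b<b′)

      c₃′ : Condition₃ _<_ (σ ∘ f) (pos ∘ σ)
      c₃′ c c′ σfc≡c σfc′≡c′ c<c′ with fixed-other σfc≡c | fixed-other σfc′≡c′
      ... | c≢i , c≢j , fc≡c | c′≢i , c′≢j , fc′≡c′ =
            <-resp⁻ (pos-σ-other c≢i c≢j) (pos-σ-other c′≢i c′≢j) (c₃ c c′ fc≡c fc′≡c′ c<c′)

      c₄′ : Condition₄ _<_ (σ ∘ f) (pos ∘ σ)
      c₄′ a b c (a<b , σfa≡b) σfc≡c c<a with fixed-other σfc≡c | spot a
      ... | c≢i , c≢j , fc≡c | at-i refl =
            <-resp⁻ (pos-σ-other c≢i c≢j) (trans (cong (pos ∘ σ) (trans (sym σfa≡b) σfi≡j)) pσj≡pi)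
              (c₃ c i fc≡c fi≡i c<a)
      ... | _ | at-j refl = ⊥-elim (no-cycle-from-j a<b σfa≡b)
      ... | c≢i , c≢j , fc≡c | other a≢i a≢j with σf-other keeps a≢i a≢j σfa≡b
      ...   | fa≡b , b≢i , b≢j =
              <-resp⁻ (pos-σ-other c≢i c≢j) (pos-σ-other b≢i b≢j) (c₄ a b c (a<b , fa≡b) fc≡c c<a)

      c₅′ : Condition₅ _<_ (σ ∘ f) (pos ∘ σ)
      c₅′ a b c (a<b , σfa≡b) σfc≡c b<c with fixed-other σfc≡c | spot a
      ... | c≢i , c≢j , fc≡c | at-i refl =
            <-resp⁻ pσi≡pj (pos-σ-other c≢i c≢j)
              (c₃ j c fj≡j fc≡c (<-resp⁻ (sym (trans (sym σfa≡b) σfi≡j)) refl b<c))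
      ... | _ | at-j refl = ⊥-elim (no-cycle-from-j a<b σfa≡b)
      ... | c≢i , c≢j , fc≡c | other a≢i a≢j with σf-other keeps a≢i a≢j σfa≡b
      ...   | fa≡b , b≢i , b≢j =
              <-resp⁻ (pos-σ-other a≢i a≢j) (pos-σ-other c≢i c≢j) (c₅ a b c (a<b , fa≡b) fc≡c b<c)

    Conditions-remove-cycle : f i ≡ j → Conditionsᴿ _<_ f pos → Conditionsᴿ _<_ (σ ∘ f) (pos ∘ σ)
    Conditions-remove-cycle fi≡j (c₁ , c₂ , c₃ , c₄ , c₅) = c₁′ , c₂′ , c₃′ , c₄′ , c₅′
      where
      fj≡i : f j ≡ i
      fj≡i = f-swap fi≡j
      keeps : ∀ {x} → x ≢ i → x ≢ j → f x ≢ i × f x ≢ j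
      keeps {x} x≢i x≢j = (λ fx≡i → x≢j (f-injective (trans fx≡i (sym fj≡i))))
                        , (λ fx≡j → x≢i (f-injective (trans fx≡j (sym fi≡j))))
      σfi≡i : σ (f i) ≡ i
      σfi≡i = trans (cong σ fi≡j) σj
      σfj≡j : σ (f j) ≡ j
      σfj≡j = trans (cong σ fj≡i) σi
      pj<pi : pos j < pos i
      pj<pi = proj₁ (c₁ i j (i<j , fi≡j))
      pσi≡pj : pos (σ i) ≡ pos j
      pσi≡pj = cong pos σi
      pσj≡pi : pos (σ j) ≡ pos i
      pσj≡pi = cong pos σj
      cycle-other : ∀ {a b} → a < b → σ (f a) ≡ b → a ≢ i × a ≢ j × f a ≡ b × b ≢ i × b ≢ j
      cycle-other {a} a<b σfa≡b with spot a
      ... | at-i refl = ⊥-elim (<-irrefl (trans (sym σfi≡i) σfa≡b) a<b)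
      ... | at-j refl = ⊥-elim (<-irrefl (trans (sym σfj≡j) σfa≡b) a<b)
      ... | other a≢i a≢j = a≢i , a≢j , σf-other keeps a≢i a≢j σfa≡b
      fixed-other : ∀ {c} → c ≢ i → c ≢ j → σ (f c) ≡ c → f c ≡ c
      fixed-other c≢i c≢j σfc≡c = proj₁ (σf-other keeps c≢i c≢j σfc≡c)

      c₁′ : Condition₁ _<_ (σ ∘ f) (pos ∘ σ)
      c₁′ a b (a<b , σfa≡b) with cycle-other a<b σfa≡b
      ... | a≢i , a≢j , fa≡b , b≢i , b≢j = cycle-off keeps c₁ a≢i a≢j b≢i b≢j a<b fa≡b

      c₂′ : Condition₂ _<_ (σ ∘ f) (pos ∘ σ)
      c₂′ a b a′ b′ (a<b , σfa≡b) (a′<b′ , σfa′≡b′) a<a′ b<b′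
        with cycle-other a<b σfa≡b | cycle-other a′<b′ σfa′≡b′
      ... | a≢i , a≢j , fa≡b , _ | _ , _ , fa′≡b′ , b′≢i , b′≢j =
            <-resp⁻ (pos-σ-other a≢i a≢j) (pos-σ-other b′≢i b′≢j)
              (c₂ a b a′ b′ (a<b , fa≡b) (a′<b′ , fa′≡b′) a<a′ b<b′)

      c₃′ : Condition₃ _<_ (σ ∘ f) (pos ∘ σ)
      c₃′ c c′ σfc≡c σfc′≡c′ c<c′ with spot c | spot c′
      ... | at-i refl | at-i refl = ⊥-elim (<-irrefl refl c<c′)
      ... | at-i refl | at-j refl = <-resp⁻ pσi≡pj pσj≡pi pj<pi
      ... | at-i refl | other c′≢i c′≢j = <-resp⁻ pσi≡pj (pos-σ-other c′≢i c′≢j)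
              (<-trans pj<pi (c₅ i j c′ (i<j , fi≡j) (fixed-other c′≢i c′≢j σfc′≡c′) (i<x⇒j<x c′≢j c<c′)))
      ... | at-j refl | at-i refl = ⊥-elim (j≮i c<c′)
      ... | at-j refl | at-j refl = ⊥-elim (<-irrefl refl c<c′)
      ... | at-j refl | other c′≢i c′≢j = <-resp⁻ pσj≡pi (pos-σ-other c′≢i c′≢j)
              (c₅ i j c′ (i<j , fi≡j) (fixed-other c′≢i c′≢j σfc′≡c′) c<c′)
      ... | other c≢i c≢j | at-i refl = <-resp⁻ (pos-σ-other c≢i c≢j) pσi≡pj
              (c₄ i j c (i<j , fi≡j) (fixed-other c≢i c≢j σfc≡c) c<c′)
      ... | other c≢i c≢j | at-j refl = <-resp⁻ (pos-σ-other c≢i c≢j) pσj≡pi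
              (<-trans (c₄ i j c (i<j , fi≡j) (fixed-other c≢i c≢j σfc≡c) (x<j⇒x<i c≢i c<c′)) pj<pi)
      ... | other c≢i c≢j | other c′≢i c′≢j = <-resp⁻ (pos-σ-other c≢i c≢j) (pos-σ-other c′≢i c′≢j)
              (c₃ c c′ (fixed-other c≢i c≢j σfc≡c) (fixed-other c′≢i c′≢j σfc′≡c′) c<c′)

      c₄′ : Condition₄ _<_ (σ ∘ f) (pos ∘ σ)
      c₄′ a b c (a<b , σfa≡b) σfc≡c c<a with cycle-other a<b σfa≡b | spot c
      ... | _ , a≢j , fa≡b , b≢i , b≢j | at-i refl = <-resp⁻ pσi≡pj (pos-σ-other b≢i b≢j)
              (<-trans pj<pi (c₂ i j a b (i<j , fi≡j) (a<b , fa≡b) c<a (<-trans (i<x⇒j<x a≢j c<a) a<b)))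
      ... | _ , _ , fa≡b , b≢i , b≢j | at-j refl = <-resp⁻ pσj≡pi (pos-σ-other b≢i b≢j)
              (c₂ i j a b (i<j , fi≡j) (a<b , fa≡b) (<-trans i<j c<a) (<-trans c<a a<b))
      ... | _ , _ , fa≡b , b≢i , b≢j | other c≢i c≢j = <-resp⁻ (pos-σ-other c≢i c≢j) (pos-σ-other b≢i b≢j)
              (c₄ a b c (a<b , fa≡b) (fixed-other c≢i c≢j σfc≡c) c<a)

      c₅′ : Condition₅ _<_ (σ ∘ f) (pos ∘ σ)
      c₅′ a b c (a<b , σfa≡b) σfc≡c b<c with cycle-other a<b σfa≡b | spot c
      ... | a≢i , a≢j , fa≡b , _ | at-i refl = <-resp⁻ (pos-σ-other a≢i a≢j) pσi≡pj
              (c₂ a b i j (a<b , fa≡b) (i<j , fi≡j) (<-trans a<b b<c) (<-trans b<c i<j))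
      ... | a≢i , a≢j , fa≡b , b≢i , _ | at-j refl = <-resp⁻ (pos-σ-other a≢i a≢j) pσj≡pi
              (<-trans (c₂ a b i j (a<b , fa≡b) (i<j , fi≡j) (<-trans a<b (x<j⇒x<i b≢i b<c)) b<c) pj<pi)
      ... | a≢i , a≢j , fa≡b , _ | other c≢i c≢j = <-resp⁻ (pos-σ-other a≢i a≢j) (pos-σ-other c≢i c≢j)
              (c₅ a b c (a<b , fa≡b) (fixed-other c≢i c≢j σfc≡c) b<c)

  -- The operator m(s k)

  data MAct (π : Permutation′ (suc m)) : Permutation′ (suc m) → Set where
    conj-step : len (s k · (π · s k)) ≡ len π + 2 → MAct π (s k · (π · s k))
    fix-step  : BothFixed (π ⟨$⟩ʳ_) → MAct π (s k · π)
    stay      : len (s k · (π · s k)) ≢ len π + 2 → ¬ BothFixed (π ⟨$⟩ʳ_) → MAct π π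

  mAct-view : ∀ π → MAct π (mAct k π)
  mAct-view π with len (s k · (π · s k)) ℕ.≟ (len π + 2)
  ... | yes len≡ = conj-step len≡
  ... | no len≢ with π ⟨$⟩ʳ i ≟ i | π ⟨$⟩ʳ j ≟ j
  ...   | yes πi≡i | yes πj≡j = fix-step (πi≡i , πj≡j)
  ...   | yes _    | no πj≢j  = stay len≢ (πj≢j ∘ proj₂)
  ...   | no πi≢i  | _        = stay len≢ (πi≢i ∘ proj₁)

  private
    len≡2+ : ∀ π → len (s k · (π · s k)) ≡ len π + 2 → len (s k · (π · s k)) ≡ suc (suc (len π))
    len≡2+ π len≡ = trans len≡ (ℕ.+-comm (len π) 2)

  mAct-involution : ∀ {π r} → MAct π r → IsInvolution π → IsInvolution r
  mAct-involution {π} (conj-step _) inv = conj-involution π inv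
  mAct-involution {π} (fix-step fixed) inv x = trans (conj-fixed≈ π fixed (π ⟨$⟩ʳ x)) (inv x)
  mAct-involution (stay _ _) inv = inv

  mAct-twoL : ∀ {π r} → MAct π r → IsInvolution π → (twoL r ≡ twoL π + 2) ⊎ (twoL r ≡ twoL π)
  mAct-twoL {π} (conj-step len≡) inv =
    inj₁ (trans (cong₂ _+_ len≡ (twoCycles-conj π inv πi≢j)) (regroup (len π) (twoCycles π)))
    where
    πi<πj = proj₁ (len-conj≡2+⇒ascent π (len≡2+ π len≡))
    πi≢j : π ⟨$⟩ʳ i ≢ j
    πi≢j πi≡j = j≮i (<-resp⁻ (sym πi≡j) (sym (trans (cong (π ⟨$⟩ʳ_) (sym πi≡j)) (inv i))) πi<πj)
    regroup : ∀ a b → (a + 2) + b ≡ (a + b) + 2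
    regroup = solve-∀
  mAct-twoL {π} (fix-step fixed) inv =
    inj₁ (trans (cong₂ _+_ (len-s·-fixed π fixed) (twoCycles-s·-fixed π fixed)) (regroup (len π) (twoCycles π)))
    where
    regroup : ∀ a b → suc a + suc b ≡ (a + b) + 2
    regroup = solve-∀
  mAct-twoL (stay _ _) inv = inj₂ refl

  mAct-Conditions : ∀ {π r} (v : Permutation′ (suc m)) → MAct π r → IsInvolution π → twoL r ≡ twoL π + 2 →
    v ⟨$⟩ˡ i < v ⟨$⟩ˡ j → Conditions π v → Conditions r (s k · v)
  mAct-Conditions {π} v (conj-step len≡) inv _ _ cond =
    Conditionsᴿ-cong (λ _ → refl) (λ x → sym (s·-⟨$⟩ˡ v x))
      (Conditionsᴿ-antimono (λ x y → <-resp⁻ (σ-involutive x) (σ-involutive y))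
        (Conditionsᴿ-relabel σ σ-involutive (Conditions-<⇒⊏ (π ⟨$⟩ʳ_) (v ⟨$⟩ˡ_) inv πi<πj not-fixed cond)))
    where
    πi<πj = proj₁ (len-conj≡2+⇒ascent π (len≡2+ π len≡))
    not-fixed = proj₂ (len-conj≡2+⇒ascent π (len≡2+ π len≡))
  mAct-Conditions {π} v (fix-step fixed) inv _ vi<vj cond =
    Conditionsᴿ-cong (λ _ → refl) (λ x → sym (s·-⟨$⟩ˡ v x))
      (Conditions-add-cycle (π ⟨$⟩ʳ_) (v ⟨$⟩ˡ_) inv fixed vi<vj cond)
  mAct-Conditions {π} v (stay _ _) inv twoL≡ _ _ =
    ⊥-elim (ℕ.m≢1+n+m (twoL π) {1} (trans twoL≡ (ℕ.+-comm (twoL π) 2)))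

  mAct-fixed : ∀ {π r} → MAct π r → BothFixed (π ⟨$⟩ʳ_) → r ≈ s k · π
  mAct-fixed {π} (conj-step len≡) fixed = ⊥-elim (proj₂ (len-conj≡2+⇒ascent π (len≡2+ π len≡)) fixed)
  mAct-fixed (fix-step _) fixed x = refl
  mAct-fixed (stay _ not-fixed) fixed = ⊥-elim (not-fixed fixed)

  mAct-ascent : ∀ {π r} → MAct π r → IsInvolution π →
                π ⟨$⟩ʳ i < π ⟨$⟩ʳ j → ¬ BothFixed (π ⟨$⟩ʳ_) →
                r ≈ s k · (π · s k)
  mAct-ascent (conj-step _) inv πi<πj not-fixed x = refl
  mAct-ascent (fix-step fixed) inv πi<πj not-fixed = ⊥-elim (not-fixed fixed)
  mAct-ascent {π} (stay len≢ _) inv πi<πj not-fixed =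
    ⊥-elim (len≢ (trans (len-conj-ascent π inv πi<πj not-fixed) (ℕ.+-comm 2 (len π))))

  InW-cons : ∀ {π π′ w} → w ⟨$⟩ˡ j < w ⟨$⟩ˡ i → IsInvolution π′ →
    (∀ ρ → IsInvolution ρ → ρ ≈ π′ → mAct k ρ ≈ π) → twoL π ≡ twoL π′ + 2 →
    InW π′ (s k · w) → InW π w
  InW-cons {π} {π′} {w} descent inv′ step twoL≡ (ws′ , prod≈ , length≡ , mWord≈ , twice≡) =
    k ∷ ws′ , prod≈′ , length≡′ , step ρ (IsInvolution-cong ρ π′ mWord≈ inv′) mWord≈ , twice≡′
    where
    ρ = mWord ws′ idₚ
    len-w : len w ≡ suc (len (s k · w))
    len-w = len-s·-descent w descent
    prod≈′ : s k · prod ws′ ≈ w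
    prod≈′ x = trans (cong σ (prod≈ x)) (σ-involutive (w ⟨$⟩ʳ x))
    length≡′ : suc (length ws′) ≡ len w
    length≡′ = trans (cong suc length≡) (sym len-w)
    twice≡′ : 2 * len w ≡ twoL π
    twice≡′ = begin
      2 * len w                 ≡⟨ cong (2 *_) len-w ⟩
      2 * suc (len (s k · w))   ≡⟨ ℕ.*-distribˡ-+ 2 1 (len (s k · w)) ⟩
      2 + 2 * len (s k · w)     ≡⟨ cong (2 +_) twice≡ ⟩
      2 + twoL π′               ≡⟨ ℕ.+-comm 2 (twoL π′) ⟩
      twoL π′ + 2               ≡⟨ sym twoL≡ ⟩
      twoL π                    ∎
      where open ≡-Reasoning

  -- If π swaps i and j, then π′ := s k · π fixes them and m(s k) · π′ = π.
  peel-cycle : ∀ {π w} → IsInvolution π → π ⟨$⟩ʳ i ≡ j → w ⟨$⟩ˡ j < w ⟨$⟩ˡ i → Conditions π w →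
    IsInvolution (s k · π) × Conditions (s k · π) (s k · w) × (InW (s k · π) (s k · w) → InW π w)
  peel-cycle {π} {w} inv πi≡j descent cond = inv′ , cond′ , InW-cons {π} {π′} {w} descent inv′ step twoL≡
    where
    π′ = s k · π
    πj≡i : π ⟨$⟩ʳ j ≡ i
    πj≡i = trans (cong (π ⟨$⟩ʳ_) (sym πi≡j)) (inv i)
    fixed′ : BothFixed (π′ ⟨$⟩ʳ_)
    fixed′ = trans (cong σ πi≡j) σj , trans (cong σ πj≡i) σi
    π≈s·π′ : π ≈ s k · π′
    π≈s·π′ x = sym (σ-involutive (π ⟨$⟩ʳ x))
    π∘σ≡σ∘π : ∀ y → π ⟨$⟩ʳ σ y ≡ σ (π ⟨$⟩ʳ y)
    π∘σ≡σ∘π y = trans (sym (σ-involutive _)) (conj-fixed≈ π′ fixed′ y)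
    inv′ : IsInvolution π′
    inv′ x = trans (cong σ (π∘σ≡σ∘π (π ⟨$⟩ʳ x))) (trans (σ-involutive _) (inv x))
    cond′ : Conditions π′ (s k · w)
    cond′ = Conditionsᴿ-cong (λ _ → refl) (λ x → sym (s·-⟨$⟩ˡ w x))
              (Conditions-remove-cycle (π ⟨$⟩ʳ_) (w ⟨$⟩ˡ_) inv πi≡j cond)
    step : ∀ ρ → IsInvolution ρ → ρ ≈ π′ → mAct k ρ ≈ π
    step ρ _ ρ≈π′ x = trans (mAct-fixed (mAct-view ρ) (BothFixed-resp (λ y → sym (ρ≈π′ y)) fixed′) x)
                            (trans (cong σ (ρ≈π′ x)) (sym (π≈s·π′ x)))
    twoL≡ : twoL π ≡ twoL π′ + 2
    twoL≡ = begin
      twoL π                               ≡⟨ twoL-cong π (s k · π′) π≈s·π′ ⟩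
      twoL (s k · π′)                      ≡⟨ cong₂ _+_ (len-s·-fixed π′ fixed′) (twoCycles-s·-fixed π′ fixed′) ⟩
      suc (len π′) + suc (twoCycles π′)    ≡⟨ regroup (len π′) (twoCycles π′) ⟩
      twoL π′ + 2                          ∎
      where
      open ≡-Reasoning
      regroup : ∀ a b → suc a + suc b ≡ (a + b) + 2
      regroup = solve-∀

  peel-conj : ∀ {π w} → IsInvolution π → π ⟨$⟩ʳ i ≢ j → w ⟨$⟩ˡ j < w ⟨$⟩ˡ i → Conditions π w →
    let π′ = s k · (π · s k) in
    IsInvolution π′ × Conditions π′ (s k · w) × (InW π′ (s k · w) → InW π w)
  peel-conj {π} {w} inv πi≢j descent cond = inv′ , cond′ , InW-cons {π} {π′} {w} descent inv′ step twoL≡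
    where
    π′ = s k · (π · s k)
    w′ = s k · w
    inv′ : IsInvolution π′
    inv′ = conj-involution π inv
    π≈conj : π ≈ s k · (π′ · s k)
    π≈conj x = sym (trans (σ-involutive _) (cong (π ⟨$⟩ʳ_) (σ-involutive x)))
    π′i≢j : π′ ⟨$⟩ʳ i ≢ j
    π′i≢j π′i≡j = πi≢j (trans (cong (π ⟨$⟩ʳ_) (sym πj≡i)) (inv j))
      where
      πj≡i : π ⟨$⟩ʳ j ≡ i
      πj≡i = σ-injective (trans (sym (cong (λ t → σ (π ⟨$⟩ʳ t)) σi)) (trans π′i≡j (sym σi)))
    w′i<w′j : w′ ⟨$⟩ˡ i < w′ ⟨$⟩ˡ j
    w′i<w′j = <-resp⁻ (s·-⟨$⟩ˡ-i w) (s·-⟨$⟩ˡ-j w) descent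
    cond⊏ : Conditionsᴿ _⊏_ (π′ ⟨$⟩ʳ_) (w′ ⟨$⟩ˡ_)
    cond⊏ = Conditionsᴿ-cong (λ _ → refl) (λ x → sym (s·-⟨$⟩ˡ w x))
              (Conditionsᴿ-relabel σ σ-involutive cond)
    π′i<π′j : π′ ⟨$⟩ʳ i < π′ ⟨$⟩ʳ j
    π′i<π′j = Conditions-⊏⇒fi<fj (π′ ⟨$⟩ʳ_) (w′ ⟨$⟩ˡ_) inv′ w′i<w′j π′i≢j cond⊏
    not-fixed′ : ¬ BothFixed (π′ ⟨$⟩ʳ_)
    not-fixed′ = Conditions-⊏⇒not-fixed (π′ ⟨$⟩ʳ_) (w′ ⟨$⟩ˡ_) inv′ w′i<w′j cond⊏
    cond′ : Conditions π′ w′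
    cond′ = Conditions-⊏⇒< (π′ ⟨$⟩ʳ_) (w′ ⟨$⟩ˡ_) inv′ (⟨$⟩ˡ-injective w′) w′i<w′j π′i≢j cond⊏
    step : ∀ ρ → IsInvolution ρ → ρ ≈ π′ → mAct k ρ ≈ π
    step ρ inv-ρ ρ≈π′ x =
      trans (mAct-ascent (mAct-view ρ) inv-ρ (<-resp⁻ (ρ≈π′ i) (ρ≈π′ j) π′i<π′j)
                         (not-fixed′ ∘ BothFixed-resp ρ≈π′) x)
            (trans (cong σ (ρ≈π′ (σ x))) (sym (π≈conj x)))
    twoL≡ : twoL π ≡ twoL π′ + 2
    twoL≡ = begin
      twoL π                               ≡⟨ twoL-cong π (s k · (π′ · s k)) π≈conj ⟩
      twoL (s k · (π′ · s k))              ≡⟨ cong₂ _+_ (len-conj-ascent π′ inv′ π′i<π′j not-fixed′)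
                                                         (twoCycles-conj π′ inv′ π′i≢j) ⟩
      suc (suc (len π′)) + twoCycles π′    ≡⟨ regroup (len π′) (twoCycles π′) ⟩
      twoL π′ + 2                          ∎
      where
      open ≡-Reasoning
      regroup : ∀ a b → suc (suc a) + b ≡ (a + b) + 2
      regroup = solve-∀

  peel : ∀ {π w} → IsInvolution π → w ⟨$⟩ˡ j < w ⟨$⟩ˡ i → Conditions π w →
    Σ[ π′ ∈ Permutation′ (suc m) ]
      IsInvolution π′ × Conditions π′ (s k · w) × (InW π′ (s k · w) → InW π w)
  peel {π} {w} inv descent cond with π ⟨$⟩ʳ i ≟ j
  ... | yes πi≡j = s k · π , peel-cycle {π} {w} inv πi≡j descent cond
  ... | no πi≢j = s k · (π · s k) , peel-conj {π} {w} inv πi≢j descent cond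

-- Every w ∈ W(π) satisfies the conditions

record WordInvariant {m : ℕ} (ws : List (Fin m)) : Set where
  field
    involution : IsInvolution (mWord ws idₚ)
    len≤length : len (prod ws) ℕ.≤ length ws
    twoL≤ : twoL (mWord ws idₚ) ℕ.≤ 2 * length ws
    conditions : length ws ≡ len (prod ws) → 2 * length ws ≡ twoL (mWord ws idₚ) →
                 Conditions (mWord ws idₚ) (prod ws)

word-invariant : ∀ {m} (ws : List (Fin m)) → WordInvariant ws
word-invariant {m} [] = record
  { involution = λ _ → refl
  ; len≤length = ℕ.≤-reflexive (len≡0 {suc m} idₚ (λ _ → refl))
  ; twoL≤ = ℕ.≤-reflexive (cong₂ _+_ (len≡0 {suc m} idₚ (λ _ → refl))
                                     (twoCycles≡0 {suc m} idₚ (λ _ → refl)))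
  ; conditions = λ _ _ → Conditions-id
  }
word-invariant {m} (k ∷ ws) = record
  { involution = mAct-involution view IH.involution
  ; len≤length = ℕ.≤-trans (len-s·≤ v) (ℕ.s≤s IH.len≤length)
  ; twoL≤ = twoL≤′ (mAct-twoL view IH.involution)
  ; conditions = conditions′
  }
  where
  open Adjacent k
  module IH = WordInvariant (word-invariant ws)
  ρ = mWord ws idₚ
  v = prod ws
  n = length ws
  view : MAct ρ (mAct k ρ)
  view = mAct-view ρ
  2[1+n]≡2n+2 : 2 * suc n ≡ 2 * n + 2
  2[1+n]≡2n+2 = trans (ℕ.*-distribˡ-+ 2 1 n) (ℕ.+-comm 2 (2 * n))
  twoL≤′ : (twoL (mAct k ρ) ≡ twoL ρ + 2) ⊎ (twoL (mAct k ρ) ≡ twoL ρ) → twoL (mAct k ρ) ℕ.≤ 2 * suc n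
  twoL≤′ (inj₁ up) =
    ℕ.≤-trans (ℕ.≤-reflexive up) (ℕ.≤-trans (ℕ.+-monoˡ-≤ 2 IH.twoL≤) (ℕ.≤-reflexive (sym 2[1+n]≡2n+2)))
  twoL≤′ (inj₂ same) = ℕ.≤-trans (ℕ.≤-reflexive same)
                         (ℕ.≤-trans IH.twoL≤ (ℕ.≤-trans (ℕ.m≤m+n (2 * n) 2) (ℕ.≤-reflexive (sym 2[1+n]≡2n+2))))
  -- Both bounds are attained only if the previous ones were, v has an ascent at k,
  -- and the step raised twoL by 2.
  conditions′ : suc n ≡ len (s k · v) → 2 * suc n ≡ twoL (mAct k ρ) → Conditions (mAct k ρ) (s k · v)
  conditions′ len≡ twoL≡ = mAct-Conditions v view IH.involution raised ascent (IH.conditions len-v≡ twoL-ρ≡)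
    where
    len-v≡ : n ≡ len v
    len-v≡ = ℕ.≤-antisym (ℕ.≤-pred (ℕ.≤-trans (ℕ.≤-reflexive len≡) (len-s·≤ v))) IH.len≤length
    ascent : v ⟨$⟩ˡ i < v ⟨$⟩ˡ j
    ascent = injective-≮⇒> (v ⟨$⟩ˡ_) (⟨$⟩ˡ-injective v) (i≢j ∘ sym) (λ vj<vi →
      ℕ.m≢1+n+m n {1} (trans len-v≡ (trans (len-s·-descent v vj<vi) (cong suc (sym len≡)))))
    not-same : ¬ (twoL (mAct k ρ) ≡ twoL ρ)
    not-same same = ℕ.m+1+n≰m (2 * n) {1}
      (subst (ℕ._≤ 2 * n) 2[1+n]≡2n+2 (ℕ.≤-trans (ℕ.≤-reflexive (trans twoL≡ same)) IH.twoL≤))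
    raised : twoL (mAct k ρ) ≡ twoL ρ + 2
    raised = [ (λ up → up) , (λ same → ⊥-elim (not-same same)) ]′ (mAct-twoL view IH.involution)
    twoL-ρ≡ : 2 * n ≡ twoL ρ
    twoL-ρ≡ = ℕ.+-cancelʳ-≡ 2 _ _ (trans (sym 2[1+n]≡2n+2) (trans twoL≡ raised))

InW⇒Conditions : ∀ {m} (π w : Permutation′ (suc m)) → InW π w → Conditions π w
InW⇒Conditions π w (ws , prod≈ , length≡ , mWord≈ , twice≡) =
  Conditionsᴿ-cong mWord≈ (⟨$⟩ˡ-cong (prod ws) w prod≈)
    (WordInvariant.conditions (word-invariant ws) (trans length≡ (sym len-prod≡))
      (trans (cong (2 *_) length≡) (trans twice≡ (sym twoL≡))))
  where
  len-prod≡ : len (prod ws) ≡ len w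
  len-prod≡ = len-cong (prod ws) w prod≈
  twoL≡ : twoL (mWord ws idₚ) ≡ twoL π
  twoL≡ = twoL-cong (mWord ws idₚ) π mWord≈

-- Every w satisfying the conditions lies in W(π)

-- An increasing position map satisfies x ≤ w⁻¹ x, and both sides sum to the same total.
increasing⇒≈id : ∀ {m} (w : Permutation′ (suc m)) →
                 (∀ (k : Fin m) → w ⟨$⟩ˡ inject₁ k < w ⟨$⟩ˡ fsuc k) → w ≈ idₚ
increasing⇒≈id {m} w increasing x = trans (cong (w ⟨$⟩ʳ_) (sym (pos≡id x))) (inverseʳ w)
  where
  x≤pos : ∀ t (x : Fin (suc m)) → toℕ x ≡ t → toℕ x ℕ.≤ toℕ (w ⟨$⟩ˡ x)
  x≤pos zero x x≡0 rewrite x≡0 = ℕ.z≤n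
  x≤pos (suc t) (fsuc y) y+1≡ = ℕ.≤-trans (ℕ.s≤s (ℕ.≤-trans (ℕ.≤-reflexive (sym (toℕ-inject₁ y)))
    (x≤pos t (inject₁ y) (trans (toℕ-inject₁ y) (ℕ.suc-injective y+1≡))))) (increasing y)
  pos≡id : ∀ x → w ⟨$⟩ˡ x ≡ x
  pos≡id x = toℕ-injective (sym (sum-≤-equal toℕ (toℕ ∘ (w ⟨$⟩ˡ_)) (λ x → x≤pos (toℕ x) x refl)
               (sum-permute toℕ (flip w)) x))

InW-sorted : ∀ {m} (π w : Permutation′ (suc m)) → IsInvolution π → Conditions π w → w ≈ idₚ → InW π w
InW-sorted π w inv cond w≈id =
  [] , (λ x → sym (w≈id x)) , sym len-w≡0 , (λ x → sym (π≈id x)) ,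
  trans (cong (2 *_) len-w≡0) (sym (cong₂ _+_ (len≡0 π π≈id) (twoCycles≡0 π π≈id)))
  where
  len-w≡0 = len≡0 w w≈id
  π≈id : π ≈ idₚ
  π≈id = Conditions-sorted⇒fixed (π ⟨$⟩ʳ_) inv
           (Conditionsᴿ-cong (λ _ → refl) (⟨$⟩ˡ-cong w idₚ w≈id) cond)

Conditions⇒InW : ∀ {m} (N : ℕ) (π w : Permutation′ (suc m)) → IsInvolution π → len w ≡ N →
                 Conditions π w → InW π w
Conditions⇒InW {m} N π w inv len≡N cond with any? (λ (k : Fin m) → w ⟨$⟩ˡ fsuc k <? w ⟨$⟩ˡ inject₁ k)
... | no no-descent = InW-sorted π w inv cond (increasing⇒≈id w (λ k →
        injective-≮⇒> (w ⟨$⟩ˡ_) (⟨$⟩ˡ-injective w) (Adjacent.i≢j k ∘ sym)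
                      (λ descent → no-descent (k , descent))))
... | yes (k , descent) with N | Adjacent.len-s·-descent k w descent
...   | zero | len≡ = ⊥-elim (ℕ.0≢1+n (trans (sym len≡N) len≡))
...   | suc N′ | len≡ with Adjacent.peel k {π} {w} inv descent cond
...     | π′ , inv′ , cond′ , lift =
          lift (Conditions⇒InW N′ π′ (s k · w) inv′ (ℕ.suc-injective (trans (sym len≡) len≡N)) cond′)

theorem2p3 : (m : ℕ) (π : Permutation′ (suc m)) → IsInvolution π →
    (w : Permutation′ (suc m)) → InW π w ⇔ Conditions π w
theorem2p3 m π inv w = mk⇔ (InW⇒Conditions π w) (Conditions⇒InW (len w) π w inv refl)
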